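{- For every $\zeta>0$ there is $m\in\mathbb{N}$ such that for all $\tau>0$ there is $\eta_2>0$ such that the following holds for all $\lambda\in[\zeta,1]$. Let $g\colon(\{0,1\}^n,\mu_{1/2})\to\{0,1\}$ and $f\colon(\{0,1\}^n,\mu_{1/4})\to[0,1]$ satisfy $\|\mathrm{T}^{1/2}_{1/4}f-\lambda g\|_1\le\eta_2$, and assume $I_i^-[f]\le\eta_2$ for all $i\in[n]$. Then for every $M\subseteq[n]$ of size $m$, $I_M[g]:=\sum_{S\supseteq M}\widehat g(S)^2\le\tau$.
   Context: $\mu_q$ is the $q$-biased product measure on $\{0,1\}^n$; $\mathrm{T}^{1/2}_{1/4}f(x)=\mathbb{E}_{\mathbf{z}\sim\mu_{1/2}}[f(x\wedge\mathbf{z})]$ (coordinatewise AND); $\|\cdot\|_1$ is w.r.t. $\mu_{1/2}$. $I_i^-[f]=\mathbb{E}_{\mathbf{x}\sim\mu_{1/4}}[\max(0,f(\mathbf{x}^{i\to0})-f(\mathbf{x}^{i\to1}))]$ ($\mathbf{x}^{i\to b}$: coordinate $i$ set to $b$). $\widehat g(S)=\mathbb{E}_{\mathbf{x}\sim\mu_{1/2}}[g(\mathbf{x})\prod_{i\in S}(2\mathbf{x}_i-1)]$ are the Fourier coefficients w.r.t. the uniform measure.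
   Formalization: The parameters ζ, τ and λ are rational, and f takes rational values in $[0,1]$. -}

module Defs where

open import Data.Bool using (Bool; true; false; _∧_; if_then_else_)
open import Data.Nat using (ℕ; zero; suc)
open import Data.Fin using (Fin)
open import Data.Vec using (Vec; []; _∷_; zipWith; _[_]≔_)
open import Data.List using (List; []; _∷_; map; _++_; foldr)
open import Data.Integer using (+_)
open import Data.Rational using (ℚ; 0ℚ; 1ℚ; ½; _+_; _*_; _-_; ∣_∣; _⊔_; _/_)

-- points of the cube {0,1}^n  (true = 1, false = 0)
Cube : ℕ → Set
Cube n = Vec Bool n

allCube : (n : ℕ) → List (Cube n)
allCube zero    = [] ∷ []
allCube (suc n) = map (false ∷_) (allCube n) ++ map (true ∷_) (allCube n)

sumℚ : List ℚ → ℚ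
sumℚ = foldr _+_ 0ℚ

bit : Bool → ℚ
bit b = if b then 1ℚ else 0ℚ

¼ : ℚ
¼ = + 1 / 4

μ : ℚ → {n : ℕ} → Cube n → ℚ
μ q []          = 1ℚ
μ q (true ∷ x)  = q * μ q x
μ q (false ∷ x) = (1ℚ - q) * μ q x

𝔼 : ℚ → (n : ℕ) → (Cube n → ℚ) → ℚ
𝔼 q n h = sumℚ (map (λ x → μ q x * h x) (allCube n))

-- T^{1/2}_{1/4} f (x) = E_{z ~ μ_{1/2}} f (x ∧ z)
T : {n : ℕ} → (Cube n → ℚ) → Cube n → ℚ
T {n} f x = 𝔼 ½ n (λ z → f (zipWith _∧_ x z))

‖_‖₁ : {n : ℕ} → (Cube n → ℚ) → ℚ
‖_‖₁ {n} h = 𝔼 ½ n (λ x → ∣ h x ∣)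

Iminus : {n : ℕ} → (Cube n → ℚ) → Fin n → ℚ
Iminus {n} f i = 𝔼 ¼ n (λ x → 0ℚ ⊔ (f (x [ i ]≔ false) - f (x [ i ]≔ true)))

-- χ_S(x) = ∏_{i ∈ S} (2 x_i - 1); S given by its indicator vector
χ : {n : ℕ} → Cube n → Cube n → ℚ
χ []          []      = 1ℚ
χ (false ∷ S) (_ ∷ x) = χ S x
χ (true ∷ S)  (b ∷ x) = ((1ℚ + 1ℚ) * bit b - 1ℚ) * χ S x

fourier : {n : ℕ} → (Cube n → ℚ) → Cube n → ℚ
fourier {n} g S = 𝔼 ½ n (λ x → g x * χ S x)

_⊆ᵇ_ : {n : ℕ} → Cube n → Cube n → Bool
[]          ⊆ᵇ []      = true
(false ∷ M) ⊆ᵇ (_ ∷ S) = M ⊆ᵇ S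
(true ∷ M)  ⊆ᵇ (b ∷ S) = b ∧ (M ⊆ᵇ S)

IM : {n : ℕ} → (Cube n → ℚ) → Cube n → ℚ
IM {n} g M = sumℚ (map (λ S → if M ⊆ᵇ S then fourier g S * fourier g S else 0ℚ) (allCube n))

{-# OPTIONS --safe #-}
module Submission where

-- Split the cube along M, writing points as (a, b) with a the coordinates in M. Then
-- I_M[g] = E_b[ĝ_b(M)²] for the fibres g_b = g(·, b), and T f (a, b) = T F_b (a) with
-- F_b(a) = E_z f(a, b ∧ z), so it suffices to bound ĝ_b(M)² on each fibre, where k = |M| = t² and tζ ≥ 2.
-- As g_b is Boolean, 2^k ĝ_b(M) is an integer, so ĝ_b(M) = 0 or |ĝ_b(M)| ≥ 2^-k. Since T damps the top
-- coefficient by 2^-k, λ|ĝ_b(M)| ≤ 2^-k |F̂_b(M)| + ε_b with ε_b = ‖T F_b − λ g_b‖₁, hence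
-- ζ ≤ |F̂_b(M)| + 2^k ε_b. On the other hand |F̂(M)| ≤ E[F·(2x_i − 1)] + I_i^-[F] (uniform measure) for
-- every i ∈ M; summing over i, with 0 ≤ F ≤ 1 and E|Σ_i (2x_i − 1)| ≤ √k, gives k|F̂_b(M)| ≤ t + N_b for
-- the total negative influence N_b of F_b. Together ĝ_b(M)² ≤ 1 ≤ t ≤ N_b + k 2^k ε_b.
-- Averaging over b, E_b ε_b = ‖T f − λ g‖₁, and E_b N_b ≤ k 2^k max_i I_i^-[f] because b ∧ z is
-- μ_{1/4}-distributed for uniform b and z, and μ_{1/2} ≤ 2^k μ_{1/4} on {0,1}^k.

open import Defs
open import Algebra.Bundles using (CommutativeRing)
open import Data.Bool using (Bool; true; false; _∧_; if_then_else_)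
open import Data.Empty using (⊥-elim)
open import Data.Fin using (Fin; zero; suc)
open import Data.Fin.Subset using (Subset; ∣_∣; ⊤; ∁)
import Data.Integer as ℤ
import Data.Integer.Properties as ℤ
open import Data.List using (List; []; _∷_; map; _++_)
import Data.List.Properties as List
open import Data.Nat as ℕ using (ℕ; zero; suc)
import Data.Nat.Properties as ℕ
open import Data.Product using (_×_; ∃-syntax; _,_; proj₁; proj₂)
import Data.Rational as ℚ
open ℚ using (ℚ; 0ℚ; 1ℚ; ½; _+_; _*_; _-_; -_; _⊔_; _≤_; _<_; nonNegative; positive)
open import Data.Rational.Properties
open import Data.Rational.Solver using (module +-*-Solver)
import Data.Rational.Unnormalised as ℚᵘ
import Data.Rational.Unnormalised.Properties as ℚᵘ
open import Data.Sum using (inj₁; inj₂)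
open import Data.Unit using (tt)
open import Data.Vec using ([]; _∷_; zipWith; _[_]≔_; lookup)
open import Relation.Binary.PropositionalEquality
open import Relation.Nullary using (yes; no)

open +-*-Solver using (solve; _:+_; _:*_; _:-_; :-_; _:=_; con)
open CommutativeRing +-*-commutativeRing using (semiring)
open import Algebra.Properties.Semiring.Exp semiring using (_^_)
open import Algebra.Properties.Semiring.Mult semiring using (×-homo-+; ×1-homo-*; ×-assoc-*) renaming (_×_ to _·_)
open import Algebra.Properties.Semiring.Sum semiring using (sum-syntax; ∑-distrib-+; sum-replicate; *-distribˡ-sum)

2ℚ : ℚ
2ℚ = 1ℚ + 1ℚ

0≤½ : 0ℚ ≤ ½
0≤½ = ≤ᵇ⇒≤ tt

fromℕ : ℕ → ℚ
fromℕ n = n · 1ℚ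

fromℕ-+ : ∀ m n → fromℕ (m ℕ.+ n) ≡ fromℕ m + fromℕ n
fromℕ-+ = ×-homo-+ 1ℚ

fromℕ-* : ∀ m n → fromℕ (m ℕ.* n) ≡ fromℕ m * fromℕ n
fromℕ-* = ×1-homo-*

infixl 8 _²
_² : ℚ → ℚ
x ² = x * x

≤-by : ∀ {x y} d → 0ℚ ≤ d → y ≡ x + d → x ≤ y
≤-by {x} d 0≤d refl = subst (_≤ x + d) (+-identityʳ x) (+-monoʳ-≤ x 0≤d)

+-nonNeg : ∀ {a b} → 0ℚ ≤ a → 0ℚ ≤ b → 0ℚ ≤ a + b
+-nonNeg {a} {b} p q = subst (_≤ a + b) (+-identityʳ 0ℚ) (+-mono-≤ p q)

*-nonNeg : ∀ {a b} → 0ℚ ≤ a → 0ℚ ≤ b → 0ℚ ≤ a * b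
*-nonNeg {a} {b} p q = nonNegative⁻¹ _ {{nonNeg*nonNeg⇒nonNeg a {{nonNegative p}} b {{nonNegative q}}}}

*-pos : ∀ {a b} → 0ℚ < a → 0ℚ < b → 0ℚ < a * b
*-pos {a} {b} p q = positive⁻¹ _ {{pos*pos⇒pos a {{positive p}} b {{positive q}}}}

*-monoˡ-≤ : ∀ {c x y} → 0ℚ ≤ c → x ≤ y → c * x ≤ c * y
*-monoˡ-≤ {c} 0≤c = *-monoˡ-≤-nonNeg c {{nonNegative 0≤c}}

+-cancelˡ-≤ : ∀ x {a b} → x + a ≤ x + b → a ≤ b
+-cancelˡ-≤ x {a} {b} x+a≤x+b = subst₂ _≤_ (cancel a) (cancel b) (+-monoʳ-≤ (- x) x+a≤x+b)
  where
  cancel : ∀ y → - x + (x + y) ≡ y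
  cancel y = solve 2 (λ x y → :- x :+ (x :+ y) := y) refl x y

x≤∣x∣ : ∀ x → x ≤ ℚ.∣ x ∣
x≤∣x∣ x with ∣p∣≡p∨∣p∣≡-p x
... | inj₁ ∣x∣≡x  = ≤-reflexive (sym ∣x∣≡x)
... | inj₂ ∣x∣≡-x = ≤-trans (≤-reflexive x≡-∣x∣) (≤-trans (neg-antimono-≤ (0≤∣p∣ x)) (0≤∣p∣ x))
  where
  x≡-∣x∣ : x ≡ - ℚ.∣ x ∣
  x≡-∣x∣ = trans (solve 1 (λ x → x := :- (:- x)) refl x) (cong -_ (sym ∣x∣≡-x))

x²≡∣x∣² : ∀ x → x ² ≡ ℚ.∣ x ∣ ²
x²≡∣x∣² x with ∣p∣≡p∨∣p∣≡-p x
... | inj₁ ∣x∣≡x  = cong₂ _*_ (sym ∣x∣≡x) (sym ∣x∣≡x)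
... | inj₂ ∣x∣≡-x = trans (solve 1 (λ x → x :* x := (:- x) :* (:- x)) refl x) (cong₂ _*_ (sym ∣x∣≡-x) (sym ∣x∣≡-x))

0≤x² : ∀ x → 0ℚ ≤ x ²
0≤x² x = subst (0ℚ ≤_) (sym (x²≡∣x∣² x)) (*-nonNeg (0≤∣p∣ x) (0≤∣p∣ x))

0≤fromℕ : ∀ n → 0ℚ ≤ fromℕ n
0≤fromℕ zero    = ≤-refl
0≤fromℕ (suc n) = +-nonNeg {1ℚ} (≤ᵇ⇒≤ tt) (0≤fromℕ n)

1≤1+fromℕ : ∀ n → 1ℚ ≤ fromℕ (suc n)
1≤1+fromℕ n = ≤-by (fromℕ n) (0≤fromℕ n) refl

0≤2^ : ∀ k → 0ℚ ≤ 2ℚ ^ k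
0≤2^ zero    = ≤ᵇ⇒≤ tt
0≤2^ (suc k) = *-nonNeg {2ℚ} (≤ᵇ⇒≤ tt) (0≤2^ k)

0<½^ : ∀ k → 0ℚ < ½ ^ k
0<½^ zero    = positive⁻¹ 1ℚ
0<½^ (suc k) = *-pos (positive⁻¹ ½) (0<½^ k)

2^*½^≡1 : ∀ k → 2ℚ ^ k * ½ ^ k ≡ 1ℚ
2^*½^≡1 zero    = refl
2^*½^≡1 (suc k) = trans (solve 2 (λ p h → (con 2ℚ :* p) :* (con ½ :* h) := p :* h) refl (2ℚ ^ k) (½ ^ k)) (2^*½^≡1 k)

1≤2^ : ∀ k → 1ℚ ≤ 2ℚ ^ k
1≤2^ zero    = ≤-refl
1≤2^ (suc k) = ≤-trans (1≤2^ k) (≤-by (2ℚ ^ k) (0≤2^ k) (solve 1 (λ p → con 2ℚ :* p := p :+ p) refl (2ℚ ^ k)))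

fromℕ≤2^ : ∀ n → fromℕ n ≤ 2ℚ ^ n
fromℕ≤2^ zero    = ≤ᵇ⇒≤ tt
fromℕ≤2^ (suc n) = subst (fromℕ (suc n) ≤_) (solve 1 (λ p → p :+ p := con 2ℚ :* p) refl (2ℚ ^ n))
  (+-mono-≤ (1≤2^ n) (fromℕ≤2^ n))

∣c*x∣≡c*∣x∣ : ∀ {c} x → 0ℚ ≤ c → ℚ.∣ c * x ∣ ≡ c * ℚ.∣ x ∣
∣c*x∣≡c*∣x∣ {c} x 0≤c = trans (∣p*q∣≡∣p∣*∣q∣ c x) (cong (_* ℚ.∣ x ∣) (0≤p⇒∣p∣≡p 0≤c))

∑-mono-≤ : ∀ k {f g : Fin k → ℚ} → (∀ i → f i ≤ g i) → ∑[ i < k ] f i ≤ ∑[ i < k ] g i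
∑-mono-≤ zero    f≤g = ≤-refl
∑-mono-≤ (suc k) f≤g = +-mono-≤ (f≤g zero) (∑-mono-≤ k (λ i → f≤g (suc i)))

∑-nonNeg : ∀ k {f : Fin k → ℚ} → (∀ i → 0ℚ ≤ f i) → 0ℚ ≤ ∑[ i < k ] f i
∑-nonNeg zero    0≤f = ≤-refl
∑-nonNeg (suc k) 0≤f = +-nonNeg (0≤f zero) (∑-nonNeg k (λ i → 0≤f (suc i)))

∑-const : ∀ k c → ∑[ i < k ] c ≡ fromℕ k * c
∑-const k c = trans (sum-replicate k) (sym (trans (×-assoc-* k 1ℚ c) (cong (k ·_) (*-identityˡ c))))

-- Expectations over the cube

sumℚ-++ : ∀ xs ys → sumℚ (xs ++ ys) ≡ sumℚ xs + sumℚ ys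
sumℚ-++ []       ys = sym (+-identityˡ _)
sumℚ-++ (x ∷ xs) ys = trans (cong (x +_) (sumℚ-++ xs ys)) (sym (+-assoc x _ _))

module _ {A : Set} where

  sumℚ-map-+ : ∀ (φ ψ : A → ℚ) xs →
    sumℚ (map (λ x → φ x + ψ x) xs) ≡ sumℚ (map φ xs) + sumℚ (map ψ xs)
  sumℚ-map-+ φ ψ []       = refl
  sumℚ-map-+ φ ψ (x ∷ xs) = trans (cong (φ x + ψ x +_) (sumℚ-map-+ φ ψ xs))
    (solve 4 (λ a b c d → (a :+ b) :+ (c :+ d) := (a :+ c) :+ (b :+ d)) refl
      (φ x) (ψ x) (sumℚ (map φ xs)) (sumℚ (map ψ xs)))

  sumℚ-map-*ˡ : ∀ c (φ : A → ℚ) xs → sumℚ (map (λ x → c * φ x) xs) ≡ c * sumℚ (map φ xs)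
  sumℚ-map-*ˡ c φ []       = sym (*-zeroʳ c)
  sumℚ-map-*ˡ c φ (x ∷ xs) = trans (cong (c * φ x +_) (sumℚ-map-*ˡ c φ xs)) (sym (*-distribˡ-+ c _ _))

  sumℚ-map-0 : ∀ (xs : List A) → sumℚ (map (λ _ → 0ℚ) xs) ≡ 0ℚ
  sumℚ-map-0 []       = refl
  sumℚ-map-0 (x ∷ xs) = trans (+-identityˡ _) (sumℚ-map-0 xs)

sumℚ-allCube-suc : ∀ n (φ : Cube (suc n) → ℚ) →
  sumℚ (map φ (allCube (suc n)))
    ≡ sumℚ (map (λ x → φ (false ∷ x)) (allCube n)) + sumℚ (map (λ x → φ (true ∷ x)) (allCube n))
sumℚ-allCube-suc n φ = begin
  sumℚ (map φ (map (false ∷_) xs ++ map (true ∷_) xs))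
    ≡⟨ cong sumℚ (List.map-++ φ (map (false ∷_) xs) (map (true ∷_) xs)) ⟩
  sumℚ (map φ (map (false ∷_) xs) ++ map φ (map (true ∷_) xs))
    ≡⟨ sumℚ-++ (map φ (map (false ∷_) xs)) (map φ (map (true ∷_) xs)) ⟩
  sumℚ (map φ (map (false ∷_) xs)) + sumℚ (map φ (map (true ∷_) xs))
    ≡⟨ cong₂ _+_ (cong sumℚ (List.map-∘ xs)) (cong sumℚ (List.map-∘ xs)) ⟨
  sumℚ (map (λ x → φ (false ∷ x)) xs) + sumℚ (map (λ x → φ (true ∷ x)) xs) ∎
  where
  open ≡-Reasoning
  xs : List (Cube n)
  xs = allCube n

𝔼-zero : ∀ q (h : Cube 0 → ℚ) → 𝔼 q 0 h ≡ h []
𝔼-zero q h = trans (+-identityʳ _) (*-identityˡ _)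

𝔼-suc : ∀ q {n} (h : Cube (suc n) → ℚ) →
  𝔼 q (suc n) h ≡ (1ℚ - q) * 𝔼 q n (λ x → h (false ∷ x)) + q * 𝔼 q n (λ x → h (true ∷ x))
𝔼-suc q {n} h = trans (sumℚ-allCube-suc n (λ x → μ q x * h x))
  (cong₂ _+_ (face (1ℚ - q) (λ x → h (false ∷ x))) (face q (λ x → h (true ∷ x))))
  where
  face : ∀ c (h′ : Cube n → ℚ) → sumℚ (map (λ x → (c * μ q x) * h′ x) (allCube n)) ≡ c * 𝔼 q n h′
  face c h′ = trans (cong sumℚ (List.map-cong (λ x → *-assoc c (μ q x) (h′ x)) (allCube n)))
    (sumℚ-map-*ˡ c (λ x → μ q x * h′ x) (allCube n))

𝔼-cong : ∀ {q n} {h h′ : Cube n → ℚ} → (∀ x → h x ≡ h′ x) → 𝔼 q n h ≡ 𝔼 q n h′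
𝔼-cong {q} {n} h≗h′ = cong sumℚ (List.map-cong (λ x → cong (μ q x *_) (h≗h′ x)) (allCube n))

𝔼-+ : ∀ q {n} (h h′ : Cube n → ℚ) → 𝔼 q n (λ x → h x + h′ x) ≡ 𝔼 q n h + 𝔼 q n h′
𝔼-+ q {n} h h′ = trans (cong sumℚ (List.map-cong (λ x → *-distribˡ-+ (μ q x) (h x) (h′ x)) (allCube n)))
  (sumℚ-map-+ (λ x → μ q x * h x) (λ x → μ q x * h′ x) (allCube n))

𝔼-*ˡ : ∀ q {n} c (h : Cube n → ℚ) → 𝔼 q n (λ x → c * h x) ≡ c * 𝔼 q n h
𝔼-*ˡ q {n} c h = trans (cong sumℚ (List.map-cong commute (allCube n))) (sumℚ-map-*ˡ c _ (allCube n))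
  where
  commute : ∀ x → μ q x * (c * h x) ≡ c * (μ q x * h x)
  commute x = solve 3 (λ m c h → m :* (c :* h) := c :* (m :* h)) refl (μ q x) c (h x)

𝔼-linear : ∀ q {n} a b (h h′ : Cube n → ℚ) →
  𝔼 q n (λ x → a * h x + b * h′ x) ≡ a * 𝔼 q n h + b * 𝔼 q n h′
𝔼-linear q a b h h′ = trans (𝔼-+ q (λ x → a * h x) (λ x → b * h′ x)) (cong₂ _+_ (𝔼-*ˡ q a h) (𝔼-*ˡ q b h′))

𝔼-neg : ∀ q {n} (h : Cube n → ℚ) → 𝔼 q n (λ x → - h x) ≡ - 𝔼 q n h
𝔼-neg q h = trans (𝔼-cong (λ x → neg≡-1* (h x))) (trans (𝔼-*ˡ q (- 1ℚ) h) (sym (neg≡-1* _)))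
  where
  neg≡-1* : ∀ x → - x ≡ - 1ℚ * x
  neg≡-1* x = solve 1 (λ x → :- x := con (- 1ℚ) :* x) refl x

𝔼-- : ∀ q {n} (h h′ : Cube n → ℚ) → 𝔼 q n (λ x → h x - h′ x) ≡ 𝔼 q n h - 𝔼 q n h′
𝔼-- q {n} h h′ = trans (𝔼-+ q h (λ x → - h′ x)) (cong (𝔼 q n h +_) (𝔼-neg q h′))

𝔼-const : ∀ q n c → 𝔼 q n (λ _ → c) ≡ c
𝔼-const q zero    c = 𝔼-zero q (λ _ → c)
𝔼-const q (suc n) c = trans (𝔼-suc q {n} (λ _ → c))
  (trans (cong₂ (λ u v → (1ℚ - q) * u + q * v) (𝔼-const q n c) (𝔼-const q n c))
    (solve 2 (λ q c → (con 1ℚ :- q) :* c :+ q :* c := c) refl q c))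

𝔼-comm : ∀ {q q′} k l (h : Cube k → Cube l → ℚ) →
  𝔼 q k (λ a → 𝔼 q′ l (h a)) ≡ 𝔼 q′ l (λ b → 𝔼 q k (λ a → h a b))
𝔼-comm {q} {q′} zero l h = trans (𝔼-zero q (λ a → 𝔼 q′ l (h a))) (𝔼-cong (λ b → sym (𝔼-zero q (λ a → h a b))))
𝔼-comm {q} {q′} (suc k) l h = begin
  𝔼 q (suc k) (λ a → 𝔼 q′ l (h a))
    ≡⟨ 𝔼-suc q (λ a → 𝔼 q′ l (h a)) ⟩
  (1ℚ - q) * 𝔼 q k (λ a → 𝔼 q′ l (h (false ∷ a))) + q * 𝔼 q k (λ a → 𝔼 q′ l (h (true ∷ a)))
    ≡⟨ cong₂ (λ u v → (1ℚ - q) * u + q * v) (𝔼-comm k l _) (𝔼-comm k l _) ⟩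
  (1ℚ - q) * 𝔼 q′ l (λ b → 𝔼 q k (λ a → h (false ∷ a) b)) + q * 𝔼 q′ l (λ b → 𝔼 q k (λ a → h (true ∷ a) b))
    ≡⟨ 𝔼-linear q′ (1ℚ - q) q (λ b → 𝔼 q k (λ a → h (false ∷ a) b)) (λ b → 𝔼 q k (λ a → h (true ∷ a) b)) ⟨
  𝔼 q′ l (λ b → (1ℚ - q) * 𝔼 q k (λ a → h (false ∷ a) b) + q * 𝔼 q k (λ a → h (true ∷ a) b))
    ≡⟨ 𝔼-cong (λ b → sym (𝔼-suc q (λ a → h a b))) ⟩
  𝔼 q′ l (λ b → 𝔼 q (suc k) (λ a → h a b)) ∎
  where open ≡-Reasoning

𝔼-∑ : ∀ q {n} k (h : Cube n → Fin k → ℚ) →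
  𝔼 q n (λ x → ∑[ i < k ] h x i) ≡ ∑[ i < k ] 𝔼 q n (λ x → h x i)
𝔼-∑ q {n} zero    h = 𝔼-const q n 0ℚ
𝔼-∑ q {n} (suc k) h = trans (𝔼-+ q (λ x → h x zero) (λ x → ∑[ i < k ] h x (suc i)))
  (cong (𝔼 q n (λ x → h x zero) +_) (𝔼-∑ q k (λ x i → h x (suc i))))

record IsProbability (q : ℚ) : Set where
  field
    0≤q   : 0ℚ ≤ q
    0≤1-q : 0ℚ ≤ 1ℚ - q

open IsProbability {{...}}

instance
  ½-isProbability : IsProbability ½
  ½-isProbability = record { 0≤q = ≤ᵇ⇒≤ tt ; 0≤1-q = ≤ᵇ⇒≤ tt }

  ¼-isProbability : IsProbability ¼
  ¼-isProbability = record { 0≤q = ≤ᵇ⇒≤ tt ; 0≤1-q = ≤ᵇ⇒≤ tt }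

module _ {q} {{_ : IsProbability q}} where

  𝔼-mono-≤ : ∀ n {h h′ : Cube n → ℚ} → (∀ x → h x ≤ h′ x) → 𝔼 q n h ≤ 𝔼 q n h′
  𝔼-mono-≤ zero    {h} {h′} h≤h′ = subst₂ _≤_ (sym (𝔼-zero q h)) (sym (𝔼-zero q h′)) (h≤h′ [])
  𝔼-mono-≤ (suc n) {h} {h′} h≤h′ = subst₂ _≤_ (sym (𝔼-suc q h)) (sym (𝔼-suc q h′))
    (+-mono-≤ (*-monoˡ-≤ 0≤1-q (𝔼-mono-≤ n (λ x → h≤h′ (false ∷ x))))
              (*-monoˡ-≤ 0≤q   (𝔼-mono-≤ n (λ x → h≤h′ (true ∷ x)))))

  𝔼-nonNeg : ∀ n {h : Cube n → ℚ} → (∀ x → 0ℚ ≤ h x) → 0ℚ ≤ 𝔼 q n h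
  𝔼-nonNeg n {h} 0≤h = subst (_≤ 𝔼 q n h) (𝔼-const q n 0ℚ) (𝔼-mono-≤ n 0≤h)

  ∣𝔼∣≤𝔼∣∣ : ∀ n (h : Cube n → ℚ) → ℚ.∣ 𝔼 q n h ∣ ≤ 𝔼 q n (λ x → ℚ.∣ h x ∣)
  ∣𝔼∣≤𝔼∣∣ zero    h = ≤-reflexive (trans (cong ℚ.∣_∣ (𝔼-zero q h)) (sym (𝔼-zero q (λ x → ℚ.∣ h x ∣))))
  ∣𝔼∣≤𝔼∣∣ (suc n) h = begin
    ℚ.∣ 𝔼 q (suc n) h ∣
      ≡⟨ cong ℚ.∣_∣ (𝔼-suc q h) ⟩
    ℚ.∣ (1ℚ - q) * A + q * B ∣
      ≤⟨ ∣p+q∣≤∣p∣+∣q∣ ((1ℚ - q) * A) (q * B) ⟩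
    ℚ.∣ (1ℚ - q) * A ∣ + ℚ.∣ q * B ∣
      ≡⟨ cong₂ _+_ (∣c*x∣≡c*∣x∣ A 0≤1-q) (∣c*x∣≡c*∣x∣ B 0≤q) ⟩
    (1ℚ - q) * ℚ.∣ A ∣ + q * ℚ.∣ B ∣
      ≤⟨ +-mono-≤ (*-monoˡ-≤ 0≤1-q (∣𝔼∣≤𝔼∣∣ n _)) (*-monoˡ-≤ 0≤q (∣𝔼∣≤𝔼∣∣ n _)) ⟩
    (1ℚ - q) * 𝔼 q n (λ x → ℚ.∣ h (false ∷ x) ∣) + q * 𝔼 q n (λ x → ℚ.∣ h (true ∷ x) ∣)
      ≡⟨ 𝔼-suc q (λ x → ℚ.∣ h x ∣) ⟨
    𝔼 q (suc n) (λ x → ℚ.∣ h x ∣) ∎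
    where
    open ≤-Reasoning
    A B : ℚ
    A = 𝔼 q n (λ x → h (false ∷ x))
    B = 𝔼 q n (λ x → h (true ∷ x))

  0⊔𝔼≤𝔼0⊔ : ∀ n (h : Cube n → ℚ) → 0ℚ ⊔ 𝔼 q n h ≤ 𝔼 q n (λ x → 0ℚ ⊔ h x)
  0⊔𝔼≤𝔼0⊔ n h = ⊔-lub (𝔼-nonNeg n (λ x → p≤p⊔q 0ℚ (h x))) (𝔼-mono-≤ n (λ x → p≤q⊔p 0ℚ (h x)))

-- Splitting the cube along a subset

merge : ∀ {n} (M : Subset n) → Cube ∣ M ∣ → Cube ∣ ∁ M ∣ → Cube n
merge []          []      []      = []
merge (true ∷ M)  (c ∷ a) b       = c ∷ merge M a b
merge (false ∷ M) a       (c ∷ b) = c ∷ merge M a b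

𝔼-merge : ∀ q {n} (M : Subset n) (h : Cube n → ℚ) →
  𝔼 q n h ≡ 𝔼 q ∣ ∁ M ∣ (λ b → 𝔼 q ∣ M ∣ (λ a → h (merge M a b)))
𝔼-merge q [] h = trans (𝔼-zero q h)
  (sym (trans (𝔼-zero q (λ b → 𝔼 q 0 (λ a → h (merge [] a b)))) (𝔼-zero q (λ a → h (merge [] a [])))))
𝔼-merge q (true ∷ M) h = begin
  𝔼 q _ h
    ≡⟨ 𝔼-suc q h ⟩
  (1ℚ - q) * 𝔼 q _ (λ x → h (false ∷ x)) + q * 𝔼 q _ (λ x → h (true ∷ x))
    ≡⟨ cong₂ (λ u v → (1ℚ - q) * u + q * v) (𝔼-merge q M _) (𝔼-merge q M _) ⟩
  (1ℚ - q) * 𝔼 q l (λ b → 𝔼 q k (λ a → h (false ∷ merge M a b)))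
    + q * 𝔼 q l (λ b → 𝔼 q k (λ a → h (true ∷ merge M a b)))
    ≡⟨ 𝔼-linear q {l} (1ℚ - q) q _ _ ⟨
  𝔼 q l (λ b → (1ℚ - q) * 𝔼 q k (λ a → h (false ∷ merge M a b)) + q * 𝔼 q k (λ a → h (true ∷ merge M a b)))
    ≡⟨ 𝔼-cong (λ b → sym (𝔼-suc q (λ a → h (merge (true ∷ M) a b)))) ⟩
  𝔼 q l (λ b → 𝔼 q (suc k) (λ a → h (merge (true ∷ M) a b))) ∎
  where
  open ≡-Reasoning
  k l : ℕ
  k = ∣ M ∣
  l = ∣ ∁ M ∣
𝔼-merge q (false ∷ M) h = begin
  𝔼 q _ h
    ≡⟨ 𝔼-suc q h ⟩
  (1ℚ - q) * 𝔼 q _ (λ x → h (false ∷ x)) + q * 𝔼 q _ (λ x → h (true ∷ x))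
    ≡⟨ cong₂ (λ u v → (1ℚ - q) * u + q * v) (𝔼-merge q M _) (𝔼-merge q M _) ⟩
  (1ℚ - q) * 𝔼 q l (λ b → 𝔼 q k (λ a → h (false ∷ merge M a b)))
    + q * 𝔼 q l (λ b → 𝔼 q k (λ a → h (true ∷ merge M a b)))
    ≡⟨ 𝔼-suc q (λ b → 𝔼 q k (λ a → h (merge (false ∷ M) a b))) ⟨
  𝔼 q (suc l) (λ b → 𝔼 q k (λ a → h (merge (false ∷ M) a b))) ∎
  where
  open ≡-Reasoning
  k l : ℕ
  k = ∣ M ∣
  l = ∣ ∁ M ∣

merge-∧ : ∀ {n} (M : Subset n) a a′ b b′ →
  zipWith _∧_ (merge M a b) (merge M a′ b′) ≡ merge M (zipWith _∧_ a a′) (zipWith _∧_ b b′)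
merge-∧ []          []      []        []      []        = refl
merge-∧ (true ∷ M)  (c ∷ a) (c′ ∷ a′) b       b′        = cong ((c ∧ c′) ∷_) (merge-∧ M a a′ b b′)
merge-∧ (false ∷ M) a       a′        (c ∷ b) (c′ ∷ b′) = cong ((c ∧ c′) ∷_) (merge-∧ M a a′ b b′)

embed : ∀ {n} (M : Subset n) → Fin ∣ M ∣ → Fin n
embed (true ∷ M)  zero    = zero
embed (true ∷ M)  (suc i) = suc (embed M i)
embed (false ∷ M) i       = suc (embed M i)

merge-[]≔ : ∀ {n} (M : Subset n) a b i v → merge M (a [ i ]≔ v) b ≡ merge M a b [ embed M i ]≔ v
merge-[]≔ (true ∷ M)  (c ∷ a) b       zero    v = refl
merge-[]≔ (true ∷ M)  (c ∷ a) b       (suc i) v = cong (c ∷_) (merge-[]≔ M a b i v)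
merge-[]≔ (false ∷ M) a       (c ∷ b) i       v = cong (c ∷_) (merge-[]≔ M a b i v)

-- Fourier coefficients

sign : Bool → ℚ
sign b = 2ℚ * bit b - 1ℚ

∂ : ∀ {n} → (Cube (suc n) → ℚ) → Cube n → ℚ
∂ g x = ½ * (g (true ∷ x) - g (false ∷ x))

fourier-cong : ∀ {n} {g g′ : Cube n → ℚ} S → (∀ x → g x ≡ g′ x) → fourier g S ≡ fourier g′ S
fourier-cong S g≗g′ = 𝔼-cong (λ x → cong (_* χ S x) (g≗g′ x))

fourier-*ˡ : ∀ {n} c (g : Cube n → ℚ) S → fourier (λ x → c * g x) S ≡ c * fourier g S
fourier-*ˡ c g S = trans (𝔼-cong (λ x → *-assoc c (g x) (χ S x))) (𝔼-*ˡ ½ c (λ x → g x * χ S x))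

fourier-false∷ : ∀ {n} (g : Cube (suc n) → ℚ) S →
  fourier g (false ∷ S) ≡ ½ * (fourier (λ x → g (false ∷ x)) S + fourier (λ x → g (true ∷ x)) S)
fourier-false∷ g S = trans (𝔼-suc ½ (λ x → g x * χ (false ∷ S) x))
  (sym (*-distribˡ-+ ½ (fourier (λ x → g (false ∷ x)) S) (fourier (λ x → g (true ∷ x)) S)))

fourier-true∷ : ∀ {n} (g : Cube (suc n) → ℚ) S → fourier g (true ∷ S) ≡ fourier (∂ g) S
fourier-true∷ {n} g S = begin
  fourier g (true ∷ S)
    ≡⟨ 𝔼-suc ½ (λ x → g x * χ (true ∷ S) x) ⟩
  ½ * 𝔼 ½ n (λ x → g (false ∷ x) * (sign false * χ S x)) + ½ * 𝔼 ½ n (λ x → g (true ∷ x) * (sign true * χ S x))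
    ≡⟨ 𝔼-linear ½ ½ ½ (λ x → g (false ∷ x) * (sign false * χ S x)) (λ x → g (true ∷ x) * (sign true * χ S x)) ⟨
  𝔼 ½ n (λ x → ½ * (g (false ∷ x) * (sign false * χ S x)) + ½ * (g (true ∷ x) * (sign true * χ S x)))
    ≡⟨ 𝔼-cong (λ x → solve 3 (λ a b c → con ½ :* (a :* (con (- 1ℚ) :* c)) :+ con ½ :* (b :* (con 1ℚ :* c))
                                       := (con ½ :* (b :- a)) :* c) refl (g (false ∷ x)) (g (true ∷ x)) (χ S x)) ⟩
  fourier (∂ g) S ∎
  where open ≡-Reasoning

fourier-- : ∀ {n} (g h : Cube n → ℚ) S → fourier (λ x → g x - h x) S ≡ fourier g S - fourier h S
fourier-- g h S = trans (𝔼-cong (λ x → solve 3 (λ g h c → (g :- h) :* c := g :* c :- h :* c) refl (g x) (h x) (χ S x)))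
  (𝔼-- ½ (λ x → g x * χ S x) (λ x → h x * χ S x))

fourier-∂ : ∀ {n} (g : Cube (suc n) → ℚ) S →
  fourier (∂ g) S ≡ ½ * (fourier (λ x → g (true ∷ x)) S - fourier (λ x → g (false ∷ x)) S)
fourier-∂ g S = trans (fourier-*ˡ ½ (λ x → g (true ∷ x) - g (false ∷ x)) S)
  (cong (½ *_) (fourier-- (λ x → g (true ∷ x)) (λ x → g (false ∷ x)) S))

∣sign∣≡1 : ∀ b → ℚ.∣ sign b ∣ ≡ 1ℚ
∣sign∣≡1 false = refl
∣sign∣≡1 true  = refl

∣χ∣≡1 : ∀ {n} (S x : Cube n) → ℚ.∣ χ S x ∣ ≡ 1ℚ
∣χ∣≡1 []          []      = refl
∣χ∣≡1 (false ∷ S) (_ ∷ x) = ∣χ∣≡1 S x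
∣χ∣≡1 (true ∷ S)  (b ∷ x) = trans (∣p*q∣≡∣p∣*∣q∣ (sign b) (χ S x)) (cong₂ _*_ (∣sign∣≡1 b) (∣χ∣≡1 S x))

0≤‖_‖₁ : ∀ {n} (g : Cube n → ℚ) → 0ℚ ≤ ‖ g ‖₁
0≤‖_‖₁ {n} g = 𝔼-nonNeg n (λ x → 0≤∣p∣ (g x))

∣fourier∣≤‖_‖₁ : ∀ {n} (g : Cube n → ℚ) S → ℚ.∣ fourier g S ∣ ≤ ‖ g ‖₁
∣fourier∣≤‖_‖₁ {n} g S = ≤-trans (∣𝔼∣≤𝔼∣∣ n (λ x → g x * χ S x)) (≤-reflexive (𝔼-cong ∣g*χ∣≡∣g∣))
  where
  ∣g*χ∣≡∣g∣ : ∀ x → ℚ.∣ g x * χ S x ∣ ≡ ℚ.∣ g x ∣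
  ∣g*χ∣≡∣g∣ x = trans (∣p*q∣≡∣p∣*∣q∣ (g x) (χ S x)) (trans (cong (ℚ.∣ g x ∣ *_) (∣χ∣≡1 S x)) (*-identityʳ _))

IM-true∷ : ∀ {n} (g : Cube (suc n) → ℚ) M → IM g (true ∷ M) ≡ IM (∂ g) M
IM-true∷ {n} g M = begin
  IM g (true ∷ M)
    ≡⟨ sumℚ-allCube-suc n (λ S → if (true ∷ M) ⊆ᵇ S then (fourier g S) ² else 0ℚ) ⟩
  sumℚ (map (λ _ → 0ℚ) (allCube n)) + sumℚ (map (λ S → if M ⊆ᵇ S then (fourier g (true ∷ S)) ² else 0ℚ) (allCube n))
    ≡⟨ cong₂ _+_ (sumℚ-map-0 (allCube n))
         (cong sumℚ (List.map-cong (λ S → cong (λ u → if M ⊆ᵇ S then u ² else 0ℚ) (fourier-true∷ g S)) (allCube n))) ⟩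
  0ℚ + IM (∂ g) M
    ≡⟨ +-identityˡ _ ⟩
  IM (∂ g) M ∎
  where open ≡-Reasoning

if-parseval : ∀ (c : Bool) a b →
  (if c then (½ * (a + b)) ² else 0ℚ) + (if c then (½ * (b - a)) ² else 0ℚ)
    ≡ ½ * ((if c then a ² else 0ℚ) + (if c then b ² else 0ℚ))
if-parseval false a b = refl
if-parseval true  a b = solve 2 (λ a b → (con ½ :* (a :+ b)) :* (con ½ :* (a :+ b)) :+ (con ½ :* (b :- a)) :* (con ½ :* (b :- a))
                                       := con ½ :* (a :* a :+ b :* b)) refl a b

IM-false∷ : ∀ {n} (g : Cube (suc n) → ℚ) M →
  IM g (false ∷ M) ≡ ½ * (IM (λ x → g (false ∷ x)) M + IM (λ x → g (true ∷ x)) M)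
IM-false∷ {n} g M = begin
  IM g (false ∷ M)
    ≡⟨ sumℚ-allCube-suc n (λ S → if (false ∷ M) ⊆ᵇ S then (fourier g S) ² else 0ℚ) ⟩
  sumℚ (map (term ĝ₀) (allCube n)) + sumℚ (map (term ĝ₁) (allCube n))
    ≡⟨ sumℚ-map-+ (term ĝ₀) (term ĝ₁) (allCube n) ⟨
  sumℚ (map (λ S → term ĝ₀ S + term ĝ₁ S) (allCube n))
    ≡⟨ cong sumℚ (List.map-cong split (allCube n)) ⟩
  sumℚ (map (λ S → ½ * (term (fourier g₀) S + term (fourier g₁) S)) (allCube n))
    ≡⟨ sumℚ-map-*ˡ ½ (λ S → term (fourier g₀) S + term (fourier g₁) S) (allCube n) ⟩
  ½ * sumℚ (map (λ S → term (fourier g₀) S + term (fourier g₁) S) (allCube n))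
    ≡⟨ cong (½ *_) (sumℚ-map-+ (term (fourier g₀)) (term (fourier g₁)) (allCube n)) ⟩
  ½ * (IM g₀ M + IM g₁ M) ∎
  where
  open ≡-Reasoning
  g₀ g₁ ĝ₀ ĝ₁ : Cube n → ℚ
  g₀ x = g (false ∷ x)
  g₁ x = g (true ∷ x)
  ĝ₀ S = fourier g (false ∷ S)
  ĝ₁ S = fourier g (true ∷ S)
  term : (Cube n → ℚ) → Cube n → ℚ
  term c S = if M ⊆ᵇ S then (c S) ² else 0ℚ
  split : ∀ S → term ĝ₀ S + term ĝ₁ S ≡ ½ * (term (fourier g₀) S + term (fourier g₁) S)
  split S = trans (cong₂ (λ u v → (if M ⊆ᵇ S then u ² else 0ℚ) + (if M ⊆ᵇ S then v ² else 0ℚ))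
                         (fourier-false∷ g S) (trans (fourier-true∷ g S) (fourier-∂ g S)))
                  (if-parseval (M ⊆ᵇ S) (fourier g₀ S) (fourier g₁ S))

IM-fibres : ∀ {n} (M : Subset n) (g : Cube n → ℚ) →
  IM g M ≡ 𝔼 ½ ∣ ∁ M ∣ (λ b → (fourier (λ a → g (merge M a b)) ⊤) ²)
IM-fibres [] g = begin
  IM g []
    ≡⟨ +-identityʳ _ ⟩
  (fourier g []) ²
    ≡⟨ cong _² (trans (𝔼-zero ½ (λ x → g x * χ [] x)) (sym (𝔼-zero ½ (λ a → g (merge [] a []) * χ [] a)))) ⟩
  (fourier (λ a → g (merge [] a [])) []) ²
    ≡⟨ 𝔼-zero ½ (λ b → (fourier (λ a → g (merge [] a b)) []) ²) ⟨
  𝔼 ½ 0 (λ b → (fourier (λ a → g (merge [] a b)) []) ²) ∎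
  where open ≡-Reasoning
IM-fibres (true ∷ M) g = trans (IM-true∷ g M) (trans (IM-fibres M (∂ g))
  (𝔼-cong (λ b → cong _² (sym (fourier-true∷ (λ a → g (merge (true ∷ M) a b)) ⊤)))))
IM-fibres (false ∷ M) g = begin
  IM g (false ∷ M)
    ≡⟨ IM-false∷ g M ⟩
  ½ * (IM (λ x → g (false ∷ x)) M + IM (λ x → g (true ∷ x)) M)
    ≡⟨ cong₂ (λ u v → ½ * (u + v)) (IM-fibres M (λ x → g (false ∷ x))) (IM-fibres M (λ x → g (true ∷ x))) ⟩
  ½ * (𝔼 ½ l (fibre false) + 𝔼 ½ l (fibre true))
    ≡⟨ *-distribˡ-+ ½ (𝔼 ½ l (fibre false)) (𝔼 ½ l (fibre true)) ⟩
  ½ * 𝔼 ½ l (fibre false) + ½ * 𝔼 ½ l (fibre true)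
    ≡⟨ 𝔼-suc ½ (λ b → (fourier (λ a → g (merge (false ∷ M) a b)) ⊤) ²) ⟨
  𝔼 ½ (suc l) (λ b → (fourier (λ a → g (merge (false ∷ M) a b)) ⊤) ²) ∎
  where
  open ≡-Reasoning
  l : ℕ
  l = ∣ ∁ M ∣
  fibre : Bool → Cube l → ℚ
  fibre c b = (fourier (λ a → g (c ∷ merge M a b)) ⊤) ²

-- The noise operator

T-false∷ : ∀ {k} (F : Cube (suc k) → ℚ) a → T F (false ∷ a) ≡ T (λ y → F (false ∷ y)) a
T-false∷ F a = trans (𝔼-suc ½ (λ z → F (zipWith _∧_ (false ∷ a) z)))
  (solve 1 (λ x → con ½ :* x :+ con ½ :* x := x) refl (T (λ y → F (false ∷ y)) a))

T-true∷ : ∀ {k} (F : Cube (suc k) → ℚ) a →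
  T F (true ∷ a) ≡ ½ * T (λ y → F (false ∷ y)) a + ½ * T (λ y → F (true ∷ y)) a
T-true∷ F a = 𝔼-suc ½ (λ z → F (zipWith _∧_ (true ∷ a) z))

∂-T : ∀ {k} (F : Cube (suc k) → ℚ) a → ∂ (T F) a ≡ ½ * T (∂ F) a
∂-T {k} F a = begin
  ½ * (T F (true ∷ a) - T F (false ∷ a))
    ≡⟨ cong₂ (λ u v → ½ * (u - v)) (T-true∷ F a) (T-false∷ F a) ⟩
  ½ * (½ * T F₀ a + ½ * T F₁ a - T F₀ a)
    ≡⟨ solve 2 (λ t₀ t₁ → con ½ :* (con ½ :* t₀ :+ con ½ :* t₁ :- t₀) := con ½ :* (con ½ :* (t₁ :- t₀)))
               refl (T F₀ a) (T F₁ a) ⟩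
  ½ * (½ * (T F₁ a - T F₀ a))
    ≡⟨ cong (½ *_) (trans (𝔼-*ˡ ½ ½ (λ z → F₁ (zipWith _∧_ a z) - F₀ (zipWith _∧_ a z)))
                          (cong (½ *_) (𝔼-- ½ (λ z → F₁ (zipWith _∧_ a z)) (λ z → F₀ (zipWith _∧_ a z))))) ⟨
  ½ * T (∂ F) a ∎
  where
  open ≡-Reasoning
  F₀ F₁ : Cube k → ℚ
  F₀ y = F (false ∷ y)
  F₁ y = F (true ∷ y)

fourier-T-⊤ : ∀ k (F : Cube k → ℚ) → fourier (T F) ⊤ ≡ ½ ^ k * fourier F ⊤
fourier-T-⊤ zero F = begin
  fourier (T F) []
    ≡⟨ 𝔼-zero ½ (λ a → T F a * χ [] a) ⟩
  T F [] * 1ℚ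
    ≡⟨ cong (_* 1ℚ) (𝔼-zero ½ (λ z → F (zipWith _∧_ [] z))) ⟩
  F [] * 1ℚ
    ≡⟨ trans (*-identityˡ _) (𝔼-zero ½ (λ a → F a * χ [] a)) ⟨
  1ℚ * fourier F [] ∎
  where open ≡-Reasoning
fourier-T-⊤ (suc k) F = begin
  fourier (T F) ⊤                    ≡⟨ fourier-true∷ (T F) ⊤ ⟩
  fourier (∂ (T F)) ⊤                ≡⟨ fourier-cong ⊤ (∂-T F) ⟩
  fourier (λ a → ½ * T (∂ F) a) ⊤    ≡⟨ fourier-*ˡ ½ (T (∂ F)) ⊤ ⟩
  ½ * fourier (T (∂ F)) ⊤            ≡⟨ cong (½ *_) (fourier-T-⊤ k (∂ F)) ⟩
  ½ * (½ ^ k * fourier (∂ F) ⊤)      ≡⟨ *-assoc ½ (½ ^ k) (fourier (∂ F) ⊤) ⟨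
  ½ ^ suc k * fourier (∂ F) ⊤        ≡⟨ cong (½ ^ suc k *_) (fourier-true∷ F ⊤) ⟨
  ½ ^ suc k * fourier F ⊤            ∎
  where open ≡-Reasoning

fourier-⊤-stability : ∀ {k} {λ′} → 0ℚ ≤ λ′ → (F G : Cube k → ℚ) →
  λ′ * ℚ.∣ fourier G ⊤ ∣ ≤ ½ ^ k * ℚ.∣ fourier F ⊤ ∣ + ‖ (λ x → T F x - λ′ * G x) ‖₁
fourier-⊤-stability {k} {λ′} 0≤λ′ F G = begin
  λ′ * ℚ.∣ fourier G ⊤ ∣
    ≡⟨ ∣c*x∣≡c*∣x∣ (fourier G ⊤) 0≤λ′ ⟨
  ℚ.∣ λ′ * fourier G ⊤ ∣
    ≡⟨ cong ℚ.∣_∣ (fourier-*ˡ λ′ G ⊤) ⟨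
  ℚ.∣ fourier (λ x → λ′ * G x) ⊤ ∣
    ≡⟨ cong ℚ.∣_∣ (trans (fourier-cong ⊤ (λ x → solve 2 (λ t g → g := t :- (t :- g)) refl (T F x) (λ′ * G x)))
                         (fourier-- (T F) E ⊤)) ⟩
  ℚ.∣ fourier (T F) ⊤ - fourier E ⊤ ∣
    ≤⟨ ∣p-q∣≤∣p∣+∣q∣ (fourier (T F) ⊤) (fourier E ⊤) ⟩
  ℚ.∣ fourier (T F) ⊤ ∣ + ℚ.∣ fourier E ⊤ ∣
    ≤⟨ +-mono-≤ (≤-reflexive (trans (cong ℚ.∣_∣ (fourier-T-⊤ k F)) (∣c*x∣≡c*∣x∣ (fourier F ⊤) (<⇒≤ (0<½^ k)))))
                (∣fourier∣≤‖ E ‖₁ ⊤) ⟩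
  ½ ^ k * ℚ.∣ fourier F ⊤ ∣ + ‖ E ‖₁ ∎
  where
  open ≤-Reasoning
  E : Cube k → ℚ
  E x = T F x - λ′ * G x

-- Negative influences and the top coefficient

negInfluence : ℚ → ∀ {n} → (Cube n → ℚ) → Fin n → ℚ
negInfluence q {n} f i = 𝔼 q n (λ x → 0ℚ ⊔ (f (x [ i ]≔ false) - f (x [ i ]≔ true)))

totalNegInfluence : ℚ → ∀ {n} → (Cube n → ℚ) → ℚ
totalNegInfluence q {n} f = ∑[ i < n ] negInfluence q f i

0≤totalNegInfluence : ∀ {q} {{_ : IsProbability q}} {n} (f : Cube n → ℚ) → 0ℚ ≤ totalNegInfluence q f
0≤totalNegInfluence {n = n} f = ∑-nonNeg n (λ i → 𝔼-nonNeg n (λ x → p≤p⊔q 0ℚ (f (x [ i ]≔ false) - f (x [ i ]≔ true))))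

∣½[b-a]∣≤½[b-a]+0⊔[a-b] : ∀ a b → ℚ.∣ ½ * (b - a) ∣ ≤ ½ * (b - a) + (0ℚ ⊔ (a - b))
∣½[b-a]∣≤½[b-a]+0⊔[a-b] a b with ∣p∣≡p∨∣p∣≡-p (½ * (b - a))
... | inj₁ ∣d∣≡d  = ≤-by (0ℚ ⊔ (a - b)) (p≤p⊔q 0ℚ (a - b)) (cong (_+ (0ℚ ⊔ (a - b))) (sym ∣d∣≡d))
... | inj₂ ∣d∣≡-d = begin
  ℚ.∣ ½ * (b - a) ∣
    ≡⟨ trans ∣d∣≡-d (solve 2 (λ a b → :- (con ½ :* (b :- a)) := con ½ :* (b :- a) :+ (a :- b)) refl a b) ⟩
  ½ * (b - a) + (a - b)
    ≤⟨ +-monoʳ-≤ (½ * (b - a)) (p≤q⊔p 0ℚ (a - b)) ⟩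
  ½ * (b - a) + (0ℚ ⊔ (a - b)) ∎
  where open ≤-Reasoning

∣fourier-⊤∣≤correlation+negInfluence : ∀ {k} (F : Cube k → ℚ) (i : Fin k) →
  ℚ.∣ fourier F ⊤ ∣ ≤ 𝔼 ½ k (λ x → F x * sign (lookup x i)) + negInfluence ½ F i
∣fourier-⊤∣≤correlation+negInfluence {suc k} F zero = begin
  ℚ.∣ fourier F ⊤ ∣
    ≡⟨ cong ℚ.∣_∣ (fourier-true∷ F ⊤) ⟩
  ℚ.∣ fourier (∂ F) ⊤ ∣
    ≤⟨ ∣fourier∣≤‖ ∂ F ‖₁ ⊤ ⟩
  𝔼 ½ k (λ x → ℚ.∣ ∂ F x ∣)
    ≤⟨ 𝔼-mono-≤ k (λ x → ∣½[b-a]∣≤½[b-a]+0⊔[a-b] (F₀ x) (F₁ x)) ⟩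
  𝔼 ½ k (λ x → ∂ F x + (0ℚ ⊔ (F₀ x - F₁ x)))
    ≡⟨ 𝔼-+ ½ (∂ F) (λ x → 0ℚ ⊔ (F₀ x - F₁ x)) ⟩
  𝔼 ½ k (∂ F) + 𝔼 ½ k (λ x → 0ℚ ⊔ (F₀ x - F₁ x))
    ≡⟨ cong₂ _+_ correlation≡ negInfluence≡ ⟨
  𝔼 ½ (suc k) (λ x → F x * sign (lookup x zero)) + negInfluence ½ F zero ∎
  where
  open ≤-Reasoning
  F₀ F₁ : Cube k → ℚ
  F₀ y = F (false ∷ y)
  F₁ y = F (true ∷ y)
  correlation≡ : 𝔼 ½ (suc k) (λ x → F x * sign (lookup x zero)) ≡ 𝔼 ½ k (∂ F)
  correlation≡ = trans (𝔼-suc ½ (λ x → F x * sign (lookup x zero)))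
    (trans (sym (𝔼-linear ½ ½ ½ (λ x → F₀ x * sign false) (λ x → F₁ x * sign true)))
      (𝔼-cong (λ x → solve 2 (λ a b → con ½ :* (a :* con (- 1ℚ)) :+ con ½ :* (b :* con 1ℚ) := con ½ :* (b :- a))
                              refl (F₀ x) (F₁ x))))
  negInfluence≡ : negInfluence ½ F zero ≡ 𝔼 ½ k (λ x → 0ℚ ⊔ (F₀ x - F₁ x))
  negInfluence≡ = trans (𝔼-suc ½ (λ x → 0ℚ ⊔ (F (x [ zero ]≔ false) - F (x [ zero ]≔ true))))
    (solve 1 (λ m → con ½ :* m :+ con ½ :* m := m) refl (𝔼 ½ k (λ x → 0ℚ ⊔ (F₀ x - F₁ x))))
∣fourier-⊤∣≤correlation+negInfluence {suc k} F (suc i) = begin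
  ℚ.∣ fourier F ⊤ ∣
    ≡⟨ cong ℚ.∣_∣ (trans (fourier-true∷ F ⊤) (fourier-∂ F ⊤)) ⟩
  ℚ.∣ ½ * (fourier F₁ ⊤ - fourier F₀ ⊤) ∣
    ≡⟨ ∣c*x∣≡c*∣x∣ (fourier F₁ ⊤ - fourier F₀ ⊤) 0≤½ ⟩
  ½ * ℚ.∣ fourier F₁ ⊤ - fourier F₀ ⊤ ∣
    ≤⟨ *-monoˡ-≤ 0≤½ (∣p-q∣≤∣p∣+∣q∣ (fourier F₁ ⊤) (fourier F₀ ⊤)) ⟩
  ½ * (ℚ.∣ fourier F₁ ⊤ ∣ + ℚ.∣ fourier F₀ ⊤ ∣)
    ≤⟨ *-monoˡ-≤ 0≤½ (+-mono-≤ (∣fourier-⊤∣≤correlation+negInfluence F₁ i)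
                               (∣fourier-⊤∣≤correlation+negInfluence F₀ i)) ⟩
  ½ * ((corr F₁ + negInfluence ½ F₁ i) + (corr F₀ + negInfluence ½ F₀ i))
    ≡⟨ solve 4 (λ c₁ n₁ c₀ n₀ → con ½ :* ((c₁ :+ n₁) :+ (c₀ :+ n₀))
                             := (con ½ :* c₀ :+ con ½ :* c₁) :+ (con ½ :* n₀ :+ con ½ :* n₁))
               refl (corr F₁) (negInfluence ½ F₁ i) (corr F₀) (negInfluence ½ F₀ i) ⟩
  (½ * corr F₀ + ½ * corr F₁) + (½ * negInfluence ½ F₀ i + ½ * negInfluence ½ F₁ i)
    ≡⟨ cong₂ _+_ (𝔼-suc ½ (λ x → F x * sign (lookup x (suc i))))
                 (𝔼-suc ½ (λ x → 0ℚ ⊔ (F (x [ suc i ]≔ false) - F (x [ suc i ]≔ true)))) ⟨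
  𝔼 ½ (suc k) (λ x → F x * sign (lookup x (suc i))) + negInfluence ½ F (suc i) ∎
  where
  open ≤-Reasoning
  F₀ F₁ : Cube k → ℚ
  F₀ y = F (false ∷ y)
  F₁ y = F (true ∷ y)
  corr : (Cube k → ℚ) → ℚ
  corr G = 𝔼 ½ k (λ x → G x * sign (lookup x i))

Σsign : ∀ {k} → Cube k → ℚ
Σsign {k} x = ∑[ i < k ] sign (lookup x i)

k∣fourier-⊤∣≤correlation+totalNegInfluence : ∀ {k} (F : Cube k → ℚ) →
  fromℕ k * ℚ.∣ fourier F ⊤ ∣ ≤ 𝔼 ½ k (λ x → F x * Σsign x) + totalNegInfluence ½ F
k∣fourier-⊤∣≤correlation+totalNegInfluence {k} F = begin
  fromℕ k * ℚ.∣ fourier F ⊤ ∣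
    ≡⟨ ∑-const k (ℚ.∣ fourier F ⊤ ∣) ⟨
  ∑[ i < k ] ℚ.∣ fourier F ⊤ ∣
    ≤⟨ ∑-mono-≤ k (∣fourier-⊤∣≤correlation+negInfluence F) ⟩
  ∑[ i < k ] (corr i + negInfluence ½ F i)
    ≡⟨ ∑-distrib-+ corr (negInfluence ½ F) ⟩
  ∑[ i < k ] corr i + totalNegInfluence ½ F
    ≡⟨ cong (_+ totalNegInfluence ½ F) (𝔼-∑ ½ k (λ x i → F x * sign (lookup x i))) ⟨
  𝔼 ½ k (λ x → ∑[ i < k ] (F x * sign (lookup x i))) + totalNegInfluence ½ F
    ≡⟨ cong (_+ totalNegInfluence ½ F) (𝔼-cong (λ x → *-distribˡ-sum (F x) (λ i → sign (lookup x i)))) ⟨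
  𝔼 ½ k (λ x → F x * Σsign x) + totalNegInfluence ½ F ∎
  where
  open ≤-Reasoning
  corr : Fin k → ℚ
  corr i = 𝔼 ½ k (λ x → F x * sign (lookup x i))

𝔼-Σsign² : ∀ k → 𝔼 ½ k (λ x → (Σsign x) ²) ≡ fromℕ k
𝔼-Σsign² zero    = 𝔼-zero ½ (λ x → (Σsign {0} x) ²)
𝔼-Σsign² (suc k) = begin
  𝔼 ½ (suc k) (λ x → (Σsign x) ²)
    ≡⟨ 𝔼-suc ½ {k} (λ x → (Σsign x) ²) ⟩
  ½ * 𝔼 ½ k (λ x → (sign false + Σsign x) ²) + ½ * 𝔼 ½ k (λ x → (sign true + Σsign x) ²)
    ≡⟨ 𝔼-linear ½ {k} ½ ½ (λ x → (sign false + Σsign x) ²) (λ x → (sign true + Σsign x) ²) ⟨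
  𝔼 ½ k (λ x → ½ * (sign false + Σsign x) ² + ½ * (sign true + Σsign x) ²)
    ≡⟨ 𝔼-cong {½} {k} (λ x → solve 1 (λ y → con ½ :* ((con (- 1ℚ) :+ y) :* (con (- 1ℚ) :+ y))
                                            :+ con ½ :* ((con 1ℚ :+ y) :* (con 1ℚ :+ y))
                                            := con 1ℚ :+ y :* y) refl (Σsign x)) ⟩
  𝔼 ½ k (λ x → 1ℚ + (Σsign x) ²)
    ≡⟨ 𝔼-+ ½ {k} (λ _ → 1ℚ) (λ x → (Σsign x) ²) ⟩
  𝔼 ½ k (λ _ → 1ℚ) + 𝔼 ½ k (λ x → (Σsign x) ²)
    ≡⟨ cong₂ _+_ (𝔼-const ½ k 1ℚ) (𝔼-Σsign² k) ⟩
  fromℕ (suc k) ∎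
  where open ≡-Reasoning

2t∣y∣≤y²+t² : ∀ t y → (t + t) * ℚ.∣ y ∣ ≤ y ² + t ²
2t∣y∣≤y²+t² t y = ≤-by ((ℚ.∣ y ∣ - t) ²) (0≤x² (ℚ.∣ y ∣ - t))
  (trans (cong (_+ t ²) (x²≡∣x∣² y))
    (solve 2 (λ a t → a :* a :+ t :* t := (t :+ t) :* a :+ (a :- t) :* (a :- t)) refl ℚ.∣ y ∣ t))

𝔼∣Σsign∣≤√k : ∀ t → 𝔼 ½ (suc t ℕ.* suc t) (λ x → ℚ.∣ Σsign x ∣) ≤ fromℕ (suc t)
𝔼∣Σsign∣≤√k t = *-cancelˡ-≤-pos (r + r) {{positive 0<r+r}} (begin
  (r + r) * 𝔼 ½ k (λ x → ℚ.∣ Σsign x ∣)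
    ≡⟨ 𝔼-*ˡ ½ {k} (r + r) (λ x → ℚ.∣ Σsign x ∣) ⟨
  𝔼 ½ k (λ x → (r + r) * ℚ.∣ Σsign x ∣)
    ≤⟨ 𝔼-mono-≤ k (λ x → 2t∣y∣≤y²+t² r (Σsign x)) ⟩
  𝔼 ½ k (λ x → (Σsign x) ² + r ²)
    ≡⟨ 𝔼-+ ½ {k} (λ x → (Σsign x) ²) (λ _ → r ²) ⟩
  𝔼 ½ k (λ x → (Σsign x) ²) + 𝔼 ½ k (λ _ → r ²)
    ≡⟨ cong₂ _+_ (trans (𝔼-Σsign² k) (fromℕ-* (suc t) (suc t))) (𝔼-const ½ k (r ²)) ⟩
  r ² + r ²
    ≡⟨ solve 1 (λ r → r :* r :+ r :* r := (r :+ r) :* r) refl r ⟩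
  (r + r) * r ∎)
  where
  open ≤-Reasoning
  k : ℕ
  k = suc t ℕ.* suc t
  r : ℚ
  r = fromℕ (suc t)
  0<r+r : 0ℚ < r + r
  0<r+r = <-≤-trans (positive⁻¹ 1ℚ) (≤-trans (1≤1+fromℕ t) (≤-by r (0≤fromℕ (suc t)) refl))

a*y≤∣y∣ : ∀ {a} y → 0ℚ ≤ a × a ≤ 1ℚ → a * y ≤ ℚ.∣ y ∣
a*y≤∣y∣ {a} y (0≤a , a≤1) = begin
  a * y             ≤⟨ *-monoˡ-≤ 0≤a (x≤∣x∣ y) ⟩
  a * ℚ.∣ y ∣       ≤⟨ *-monoʳ-≤-nonNeg ℚ.∣ y ∣ {{nonNegative (0≤∣p∣ y)}} a≤1 ⟩
  1ℚ * ℚ.∣ y ∣      ≡⟨ *-identityˡ ℚ.∣ y ∣ ⟩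
  ℚ.∣ y ∣           ∎
  where open ≤-Reasoning

-- Integrality

IsInteger : ℚ → Set
IsInteger x = ∃[ a ] ∃[ b ] x ≡ fromℕ a - fromℕ b

isInteger-+ : ∀ {x y} → IsInteger x → IsInteger y → IsInteger (x + y)
isInteger-+ (a , b , refl) (c , d , refl) = a ℕ.+ c , b ℕ.+ d ,
  trans (solve 4 (λ a b c d → (a :- b) :+ (c :- d) := (a :+ c) :- (b :+ d)) refl (fromℕ a) (fromℕ b) (fromℕ c) (fromℕ d))
        (sym (cong₂ _-_ (fromℕ-+ a c) (fromℕ-+ b d)))

isInteger-2^*𝔼½ : ∀ k (h : Cube k → ℚ) → (∀ x → IsInteger (h x)) → IsInteger (2ℚ ^ k * 𝔼 ½ k h)
isInteger-2^*𝔼½ zero    h h∈ℤ = subst IsInteger (sym (trans (*-identityˡ _) (𝔼-zero ½ h))) (h∈ℤ [])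
isInteger-2^*𝔼½ (suc k) h h∈ℤ = subst IsInteger (sym split)
  (isInteger-+ (isInteger-2^*𝔼½ k h₀ (λ x → h∈ℤ (false ∷ x))) (isInteger-2^*𝔼½ k h₁ (λ x → h∈ℤ (true ∷ x))))
  where
  h₀ h₁ : Cube k → ℚ
  h₀ x = h (false ∷ x)
  h₁ x = h (true ∷ x)
  split : 2ℚ ^ suc k * 𝔼 ½ (suc k) h ≡ 2ℚ ^ k * 𝔼 ½ k h₀ + 2ℚ ^ k * 𝔼 ½ k h₁
  split = trans (cong (2ℚ ^ suc k *_) (𝔼-suc ½ h))
    (solve 3 (λ p a b → (con 2ℚ :* p) :* (con ½ :* a :+ con ½ :* b) := p :* a :+ p :* b) refl (2ℚ ^ k) (𝔼 ½ k h₀) (𝔼 ½ k h₁))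

isInteger-bit*χ : ∀ {n} b (S x : Cube n) → IsInteger (bit b * χ S x)
isInteger-bit*χ false S x = 0 , 0 , *-zeroˡ (χ S x)
isInteger-bit*χ true  S x with ∣p∣≡p∨∣p∣≡-p (χ S x)
... | inj₁ ∣χ∣≡χ  = 1 , 0 , trans (*-identityˡ _) (trans (sym ∣χ∣≡χ) (∣χ∣≡1 S x))
... | inj₂ ∣χ∣≡-χ = 0 , 1 , trans (*-identityˡ _)
  (trans (solve 1 (λ c → c := :- (:- c)) refl (χ S x)) (cong -_ (trans (sym ∣χ∣≡-χ) (∣χ∣≡1 S x))))

1≤∣fromℕ-fromℕ∣ : ∀ a b → fromℕ a - fromℕ b ≢ 0ℚ → 1ℚ ≤ ℚ.∣ fromℕ a - fromℕ b ∣
1≤∣fromℕ-fromℕ∣ zero    zero    ≢0 = ⊥-elim (≢0 refl)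
1≤∣fromℕ-fromℕ∣ (suc a) zero    _  = ≤-trans (1≤1+fromℕ a)
  (subst (λ u → fromℕ (suc a) ≤ ℚ.∣ u ∣) (sym (+-identityʳ (fromℕ (suc a)))) (x≤∣x∣ (fromℕ (suc a))))
1≤∣fromℕ-fromℕ∣ zero    (suc b) _  = ≤-trans (1≤1+fromℕ b)
  (subst (λ u → fromℕ (suc b) ≤ ℚ.∣ u ∣) (sym (+-identityˡ (- fromℕ (suc b))))
    (subst (fromℕ (suc b) ≤_) (sym (∣-p∣≡∣p∣ (fromℕ (suc b)))) (x≤∣x∣ (fromℕ (suc b)))))
1≤∣fromℕ-fromℕ∣ (suc a) (suc b) ≢0 =
  subst (λ u → 1ℚ ≤ ℚ.∣ u ∣) (sym shift) (1≤∣fromℕ-fromℕ∣ a b (λ eq → ≢0 (trans shift eq)))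
  where
  shift : fromℕ (suc a) - fromℕ (suc b) ≡ fromℕ a - fromℕ b
  shift = solve 2 (λ a b → (con 1ℚ :+ a) :- (con 1ℚ :+ b) := a :- b) refl (fromℕ a) (fromℕ b)

1≤∣integer∣ : ∀ {x} → IsInteger x → x ≢ 0ℚ → 1ℚ ≤ ℚ.∣ x ∣
1≤∣integer∣ (a , b , refl) = 1≤∣fromℕ-fromℕ∣ a b

1≤2^n∣fourier-bit∣ : ∀ {n} (g : Cube n → Bool) S → fourier (λ x → bit (g x)) S ≢ 0ℚ →
  1ℚ ≤ 2ℚ ^ n * ℚ.∣ fourier (λ x → bit (g x)) S ∣
1≤2^n∣fourier-bit∣ {n} g S ĝ≢0 = subst (1ℚ ≤_) (∣c*x∣≡c*∣x∣ ĝ (0≤2^ n))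
  (1≤∣integer∣ (isInteger-2^*𝔼½ n (λ x → bit (g x) * χ S x) (λ x → isInteger-bit*χ (g x) S x)) 2^n*ĝ≢0)
  where
  ĝ : ℚ
  ĝ = fourier (λ x → bit (g x)) S
  2^n*ĝ≢0 : 2ℚ ^ n * ĝ ≢ 0ℚ
  2^n*ĝ≢0 eq = ĝ≢0 (begin
    ĝ                           ≡⟨ *-identityˡ ĝ ⟨
    1ℚ * ĝ                      ≡⟨ cong (_* ĝ) (2^*½^≡1 n) ⟨
    (2ℚ ^ n * ½ ^ n) * ĝ        ≡⟨ solve 3 (λ p h g → (p :* h) :* g := h :* (p :* g)) refl (2ℚ ^ n) (½ ^ n) ĝ ⟩
    ½ ^ n * (2ℚ ^ n * ĝ)        ≡⟨ cong (½ ^ n *_) eq ⟩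
    ½ ^ n * 0ℚ                  ≡⟨ *-zeroʳ (½ ^ n) ⟩
    0ℚ                          ∎)
    where open ≡-Reasoning

fourier-bit²≤1 : ∀ {n} (g : Cube n → Bool) S → (fourier (λ x → bit (g x)) S) ² ≤ 1ℚ
fourier-bit²≤1 {n} g S = begin
  ĝ * ĝ                      ≡⟨ x²≡∣x∣² ĝ ⟩
  ℚ.∣ ĝ ∣ * ℚ.∣ ĝ ∣          ≤⟨ *-monoˡ-≤ (0≤∣p∣ ĝ) ∣ĝ∣≤1 ⟩
  ℚ.∣ ĝ ∣ * 1ℚ               ≡⟨ *-identityʳ ℚ.∣ ĝ ∣ ⟩
  ℚ.∣ ĝ ∣                    ≤⟨ ∣ĝ∣≤1 ⟩
  1ℚ                         ∎
  where
  open ≤-Reasoning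
  ĝ : ℚ
  ĝ = fourier (λ x → bit (g x)) S
  ∣bit∣≤1 : ∀ b → ℚ.∣ bit b ∣ ≤ 1ℚ
  ∣bit∣≤1 false = ≤ᵇ⇒≤ tt
  ∣bit∣≤1 true  = ≤ᵇ⇒≤ tt
  ∣ĝ∣≤1 : ℚ.∣ ĝ ∣ ≤ 1ℚ
  ∣ĝ∣≤1 = ≤-trans (∣fourier∣≤‖ (λ x → bit (g x)) ‖₁ S)
    (subst (‖ (λ x → bit (g x)) ‖₁ ≤_) (𝔼-const ½ n 1ℚ) (𝔼-mono-≤ n (λ x → ∣bit∣≤1 (g x))))

-- A single fibre

r≤N+r*r*e : ∀ {r ζ a N e} → 0ℚ ≤ r → 2ℚ ≤ r * ζ → ζ ≤ a + e → r * r * a ≤ r + N → r ≤ N + r * r * e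
r≤N+r*r*e {r} {ζ} {a} {N} {e} 0≤r 2≤rζ ζ≤a+e rra≤r+N = +-cancelˡ-≤ r (begin
  r + r                   ≡⟨ solve 1 (λ r → r :+ r := r :* con 2ℚ) refl r ⟩
  r * 2ℚ                  ≤⟨ *-monoˡ-≤ 0≤r 2≤rζ ⟩
  r * (r * ζ)             ≡⟨ *-assoc r r ζ ⟨
  r * r * ζ               ≤⟨ *-monoˡ-≤ (*-nonNeg 0≤r 0≤r) ζ≤a+e ⟩
  r * r * (a + e)         ≡⟨ *-distribˡ-+ (r * r) a e ⟩
  r * r * a + r * r * e   ≤⟨ +-monoˡ-≤ (r * r * e) rra≤r+N ⟩
  r + N + r * r * e       ≡⟨ +-assoc r N (r * r * e) ⟩
  r + (N + r * r * e)     ∎)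
  where open ≤-Reasoning

ζ≤∣fourier-F-⊤∣+2^k‖TF-λ′g‖₁ : ∀ {k ζ λ′} → 0ℚ ≤ ζ → ζ ≤ λ′ → (F : Cube k → ℚ) (g : Cube k → Bool) →
  fourier (λ x → bit (g x)) ⊤ ≢ 0ℚ →
  ζ ≤ ℚ.∣ fourier F ⊤ ∣ + 2ℚ ^ k * ‖ (λ x → T F x - λ′ * bit (g x)) ‖₁
ζ≤∣fourier-F-⊤∣+2^k‖TF-λ′g‖₁ {k} {ζ} {λ′} 0≤ζ ζ≤λ′ F g ĝ≢0 = begin
  ζ                                  ≤⟨ ζ≤λ′ ⟩
  λ′                                 ≡⟨ *-identityʳ λ′ ⟨
  λ′ * 1ℚ                            ≤⟨ *-monoˡ-≤ 0≤λ′ (1≤2^n∣fourier-bit∣ g ⊤ ĝ≢0) ⟩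
  λ′ * (2ℚ ^ k * ℚ.∣ ĝ ∣)            ≡⟨ solve 3 (λ l p g → l :* (p :* g) := p :* (l :* g)) refl λ′ (2ℚ ^ k) ℚ.∣ ĝ ∣ ⟩
  2ℚ ^ k * (λ′ * ℚ.∣ ĝ ∣)            ≤⟨ *-monoˡ-≤ (0≤2^ k) (fourier-⊤-stability 0≤λ′ F (λ x → bit (g x))) ⟩
  2ℚ ^ k * (½ ^ k * a + E)           ≡⟨ solve 4 (λ p h a e → p :* (h :* a :+ e) := (p :* h) :* a :+ p :* e) refl (2ℚ ^ k) (½ ^ k) a E ⟩
  (2ℚ ^ k * ½ ^ k) * a + 2ℚ ^ k * E  ≡⟨ cong (λ u → u * a + 2ℚ ^ k * E) (2^*½^≡1 k) ⟩
  1ℚ * a + 2ℚ ^ k * E                ≡⟨ cong (_+ 2ℚ ^ k * E) (*-identityˡ a) ⟩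
  a + 2ℚ ^ k * E                     ∎
  where
  open ≤-Reasoning
  0≤λ′ : 0ℚ ≤ λ′
  0≤λ′ = ≤-trans 0≤ζ ζ≤λ′
  ĝ a E : ℚ
  ĝ = fourier (λ x → bit (g x)) ⊤
  a = ℚ.∣ fourier F ⊤ ∣
  E = ‖ (λ x → T F x - λ′ * bit (g x)) ‖₁

k∣fourier-⊤∣≤√k+totalNegInfluence : ∀ t (F : Cube (suc t ℕ.* suc t) → ℚ) → (∀ x → 0ℚ ≤ F x × F x ≤ 1ℚ) →
  fromℕ (suc t) * fromℕ (suc t) * ℚ.∣ fourier F ⊤ ∣ ≤ fromℕ (suc t) + totalNegInfluence ½ F
k∣fourier-⊤∣≤√k+totalNegInfluence t F F∈[0,1] = begin
  fromℕ (suc t) * fromℕ (suc t) * ℚ.∣ fourier F ⊤ ∣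
    ≡⟨ cong (_* ℚ.∣ fourier F ⊤ ∣) (fromℕ-* (suc t) (suc t)) ⟨
  fromℕ k * ℚ.∣ fourier F ⊤ ∣
    ≤⟨ k∣fourier-⊤∣≤correlation+totalNegInfluence F ⟩
  𝔼 ½ k (λ x → F x * Σsign x) + totalNegInfluence ½ F
    ≤⟨ +-monoˡ-≤ (totalNegInfluence ½ F) (𝔼-mono-≤ k (λ x → a*y≤∣y∣ (Σsign x) (F∈[0,1] x))) ⟩
  𝔼 ½ k (λ x → ℚ.∣ Σsign x ∣) + totalNegInfluence ½ F
    ≤⟨ +-monoˡ-≤ (totalNegInfluence ½ F) (𝔼∣Σsign∣≤√k t) ⟩
  fromℕ (suc t) + totalNegInfluence ½ F ∎
  where
  open ≤-Reasoning
  k : ℕ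
  k = suc t ℕ.* suc t

fibre-bound : ∀ {t ζ λ′ k} → 0ℚ ≤ ζ → 2ℚ ≤ fromℕ (suc t) * ζ → ζ ≤ λ′ → k ≡ suc t ℕ.* suc t →
  (F : Cube k → ℚ) → (∀ x → 0ℚ ≤ F x × F x ≤ 1ℚ) → (g : Cube k → Bool) →
  (fourier (λ x → bit (g x)) ⊤) ²
    ≤ totalNegInfluence ½ F + fromℕ k * (2ℚ ^ k * ‖ (λ x → T F x - λ′ * bit (g x)) ‖₁)
fibre-bound {t} {λ′ = λ′} {k} 0≤ζ 2≤rζ ζ≤λ′ refl F F∈[0,1] g with fourier (λ x → bit (g x)) ⊤ ≟ 0ℚ
... | yes ĝ≡0 = subst (λ u → u ² ≤ N + fromℕ k * e) (sym ĝ≡0)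
  (+-nonNeg (0≤totalNegInfluence F) (*-nonNeg (0≤fromℕ k) (*-nonNeg (0≤2^ k) (0≤‖ (λ x → T F x - λ′ * bit (g x)) ‖₁))))
  where
  N e : ℚ
  N = totalNegInfluence ½ F
  e = 2ℚ ^ k * ‖ (λ x → T F x - λ′ * bit (g x)) ‖₁
... | no ĝ≢0 = begin
  (fourier (λ x → bit (g x)) ⊤) ²  ≤⟨ fourier-bit²≤1 g ⊤ ⟩
  1ℚ                               ≤⟨ 1≤1+fromℕ t ⟩
  r                                ≤⟨ r≤N+r*r*e (0≤fromℕ (suc t)) 2≤rζ
                                        (ζ≤∣fourier-F-⊤∣+2^k‖TF-λ′g‖₁ 0≤ζ ζ≤λ′ F g ĝ≢0)
                                        (k∣fourier-⊤∣≤√k+totalNegInfluence t F F∈[0,1]) ⟩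
  N + r * r * e                    ≡⟨ cong (λ u → N + u * e) (fromℕ-* (suc t) (suc t)) ⟨
  N + fromℕ k * e                  ∎
  where
  open ≤-Reasoning
  r N e : ℚ
  r = fromℕ (suc t)
  N = totalNegInfluence ½ F
  e = 2ℚ ^ k * ‖ (λ x → T F x - λ′ * bit (g x)) ‖₁

-- Averaging over the fibres

fibreT : ∀ {n} (M : Subset n) → (Cube n → ℚ) → Cube ∣ ∁ M ∣ → Cube ∣ M ∣ → ℚ
fibreT M f b y = 𝔼 ½ ∣ ∁ M ∣ (λ z → f (merge M y (zipWith _∧_ b z)))

fibreT∈[0,1] : ∀ {n} (M : Subset n) {f : Cube n → ℚ} → (∀ x → 0ℚ ≤ f x × f x ≤ 1ℚ) →
  ∀ b y → 0ℚ ≤ fibreT M f b y × fibreT M f b y ≤ 1ℚ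
fibreT∈[0,1] {n} M {f} f∈[0,1] b y =
  𝔼-nonNeg l (λ z → proj₁ (f∈[0,1] (point z))) ,
  subst (fibreT M f b y ≤_) (𝔼-const ½ l 1ℚ) (𝔼-mono-≤ l (λ z → proj₂ (f∈[0,1] (point z))))
  where
  l : ℕ
  l = ∣ ∁ M ∣
  point : Cube l → Cube n
  point z = merge M y (zipWith _∧_ b z)

T-merge : ∀ {n} (M : Subset n) (f : Cube n → ℚ) a b → T f (merge M a b) ≡ T (fibreT M f b) a
T-merge M f a b = trans (𝔼-merge ½ M (λ z → f (zipWith _∧_ (merge M a b) z)))
  (trans (𝔼-cong (λ z′ → 𝔼-cong (λ z → cong f (merge-∧ M a z b z′))))
         (𝔼-comm ∣ ∁ M ∣ ∣ M ∣ (λ z′ z → f (merge M (zipWith _∧_ a z) (zipWith _∧_ b z′)))))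

𝔼-fibre-distance≡‖Tf-λ′g‖₁ : ∀ {n} (M : Subset n) (f : Cube n → ℚ) (g : Cube n → Bool) λ′ →
  𝔼 ½ ∣ ∁ M ∣ (λ b → ‖ (λ a → T (fibreT M f b) a - λ′ * bit (g (merge M a b))) ‖₁)
    ≡ ‖ (λ x → T f x - λ′ * bit (g x)) ‖₁
𝔼-fibre-distance≡‖Tf-λ′g‖₁ M f g λ′ = sym (trans (𝔼-merge ½ M (λ x → ℚ.∣ T f x - λ′ * bit (g x) ∣))
  (𝔼-cong (λ b → 𝔼-cong (λ a → cong (λ u → ℚ.∣ u - λ′ * bit (g (merge M a b)) ∣) (T-merge M f a b)))))

𝔼½-𝔼½-∧≡𝔼¼ : ∀ l (h : Cube l → ℚ) → 𝔼 ½ l (λ b → 𝔼 ½ l (λ z → h (zipWith _∧_ b z))) ≡ 𝔼 ¼ l h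
𝔼½-𝔼½-∧≡𝔼¼ zero h = trans (𝔼-zero ½ (λ b → 𝔼 ½ 0 (λ z → h (zipWith _∧_ b z))))
  (trans (𝔼-zero ½ (λ z → h (zipWith _∧_ [] z))) (sym (𝔼-zero ¼ h)))
𝔼½-𝔼½-∧≡𝔼¼ (suc l) h = begin
  𝔼 ½ (suc l) (λ b → 𝔼 ½ (suc l) (λ z → h (zipWith _∧_ b z)))
    ≡⟨ 𝔼-suc ½ (λ b → 𝔼 ½ (suc l) (λ z → h (zipWith _∧_ b z))) ⟩
  ½ * 𝔼 ½ l (λ b → 𝔼 ½ (suc l) (λ z → h (zipWith _∧_ (false ∷ b) z)))
    + ½ * 𝔼 ½ l (λ b → 𝔼 ½ (suc l) (λ z → h (zipWith _∧_ (true ∷ b) z)))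
    ≡⟨ cong₂ (λ u v → ½ * u + ½ * v) (𝔼-cong (λ b → 𝔼-suc ½ (λ z → h (zipWith _∧_ (false ∷ b) z))))
                                     (𝔼-cong (λ b → 𝔼-suc ½ (λ z → h (zipWith _∧_ (true ∷ b) z)))) ⟩
  ½ * 𝔼 ½ l (λ b → ½ * U b + ½ * U b) + ½ * 𝔼 ½ l (λ b → ½ * U b + ½ * V b)
    ≡⟨ cong₂ (λ u v → ½ * u + ½ * v) (𝔼-linear ½ ½ ½ U U) (𝔼-linear ½ ½ ½ U V) ⟩
  ½ * (½ * 𝔼 ½ l U + ½ * 𝔼 ½ l U) + ½ * (½ * 𝔼 ½ l U + ½ * 𝔼 ½ l V)
    ≡⟨ cong₂ (λ u v → ½ * (½ * u + ½ * u) + ½ * (½ * u + ½ * v)) (𝔼½-𝔼½-∧≡𝔼¼ l h₀) (𝔼½-𝔼½-∧≡𝔼¼ l h₁) ⟩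
  ½ * (½ * 𝔼 ¼ l h₀ + ½ * 𝔼 ¼ l h₀) + ½ * (½ * 𝔼 ¼ l h₀ + ½ * 𝔼 ¼ l h₁)
    ≡⟨ solve 2 (λ a b → con ½ :* (con ½ :* a :+ con ½ :* a) :+ con ½ :* (con ½ :* a :+ con ½ :* b)
                      := con (1ℚ - ¼) :* a :+ con ¼ :* b) refl (𝔼 ¼ l h₀) (𝔼 ¼ l h₁) ⟩
  (1ℚ - ¼) * 𝔼 ¼ l h₀ + ¼ * 𝔼 ¼ l h₁
    ≡⟨ 𝔼-suc ¼ h ⟨
  𝔼 ¼ (suc l) h ∎
  where
  open ≡-Reasoning
  h₀ h₁ U V : Cube l → ℚ
  h₀ y = h (false ∷ y)
  h₁ y = h (true ∷ y)
  U b = 𝔼 ½ l (λ z → h₀ (zipWith _∧_ b z))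
  V b = 𝔼 ½ l (λ z → h₁ (zipWith _∧_ b z))

𝔼½≤2^*𝔼¼ : ∀ k (h : Cube k → ℚ) → (∀ x → 0ℚ ≤ h x) → 𝔼 ½ k h ≤ 2ℚ ^ k * 𝔼 ¼ k h
𝔼½≤2^*𝔼¼ zero    h 0≤h = ≤-reflexive (trans (𝔼-zero ½ h) (sym (trans (*-identityˡ _) (𝔼-zero ¼ h))))
𝔼½≤2^*𝔼¼ (suc k) h 0≤h = begin
  𝔼 ½ (suc k) h
    ≡⟨ 𝔼-suc ½ h ⟩
  ½ * 𝔼 ½ k h₀ + ½ * 𝔼 ½ k h₁
    ≤⟨ +-mono-≤ (*-monoˡ-≤ 0≤½ (𝔼½≤2^*𝔼¼ k h₀ (λ x → 0≤h (false ∷ x))))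
                (*-monoˡ-≤ 0≤½ (𝔼½≤2^*𝔼¼ k h₁ (λ x → 0≤h (true ∷ x)))) ⟩
  ½ * (p * a) + ½ * (p * b)
    ≤⟨ ≤-by (p * a) (*-nonNeg (0≤2^ k) (𝔼-nonNeg k (λ x → 0≤h (false ∷ x))))
         (solve 3 (λ p a b → (con 2ℚ :* p) :* (con (1ℚ - ¼) :* a :+ con ¼ :* b)
                           := (con ½ :* (p :* a) :+ con ½ :* (p :* b)) :+ p :* a) refl p a b) ⟩
  2ℚ ^ suc k * ((1ℚ - ¼) * a + ¼ * b)
    ≡⟨ cong (2ℚ ^ suc k *_) (𝔼-suc ¼ h) ⟨
  2ℚ ^ suc k * 𝔼 ¼ (suc k) h ∎
  where
  open ≤-Reasoning
  h₀ h₁ : Cube k → ℚ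
  h₀ y = h (false ∷ y)
  h₁ y = h (true ∷ y)
  p a b : ℚ
  p = 2ℚ ^ k
  a = 𝔼 ¼ k h₀
  b = 𝔼 ¼ k h₁

𝔼-negInfluence-fibreT : ∀ {n} (M : Subset n) (f : Cube n → ℚ) (i : Fin ∣ M ∣) →
  𝔼 ½ ∣ ∁ M ∣ (λ b → negInfluence ½ (fibreT M f b) i) ≤ 2ℚ ^ ∣ M ∣ * Iminus f (embed M i)
𝔼-negInfluence-fibreT {n} M f i = begin
  𝔼 ½ l (λ b → negInfluence ½ (fibreT M f b) i)
    ≤⟨ 𝔼-mono-≤ l (λ b → 𝔼-mono-≤ k (λ a → negPart≤𝔼negPart a b)) ⟩
  𝔼 ½ l (λ b → 𝔼 ½ k (λ a → 𝔼 ½ l (λ z → Φ (merge M a (zipWith _∧_ b z)))))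
    ≡⟨ 𝔼-comm k l (λ a b → 𝔼 ½ l (λ z → Φ (merge M a (zipWith _∧_ b z)))) ⟨
  𝔼 ½ k (λ a → 𝔼 ½ l (λ b → 𝔼 ½ l (λ z → Φ (merge M a (zipWith _∧_ b z)))))
    ≡⟨ 𝔼-cong (λ a → 𝔼½-𝔼½-∧≡𝔼¼ l (λ y → Φ (merge M a y))) ⟩
  𝔼 ½ k (λ a → 𝔼 ¼ l (λ y → Φ (merge M a y)))
    ≤⟨ 𝔼½≤2^*𝔼¼ k (λ a → 𝔼 ¼ l (λ y → Φ (merge M a y))) (λ a → 𝔼-nonNeg l (λ y → 0≤Φ (merge M a y))) ⟩
  2ℚ ^ k * 𝔼 ¼ k (λ a → 𝔼 ¼ l (λ y → Φ (merge M a y)))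
    ≡⟨ cong (2ℚ ^ k *_) (trans (𝔼-comm k l (λ a y → Φ (merge M a y))) (sym (𝔼-merge ¼ M Φ))) ⟩
  2ℚ ^ k * Iminus f j ∎
  where
  open ≤-Reasoning
  k l : ℕ
  k = ∣ M ∣
  l = ∣ ∁ M ∣
  j : Fin n
  j = embed M i
  Φ : Cube n → ℚ
  Φ x = 0ℚ ⊔ (f (x [ j ]≔ false) - f (x [ j ]≔ true))
  0≤Φ : ∀ x → 0ℚ ≤ Φ x
  0≤Φ x = p≤p⊔q 0ℚ (f (x [ j ]≔ false) - f (x [ j ]≔ true))
  negPart≤𝔼negPart : ∀ a b → 0ℚ ⊔ (fibreT M f b (a [ i ]≔ false) - fibreT M f b (a [ i ]≔ true))
                         ≤ 𝔼 ½ l (λ z → Φ (merge M a (zipWith _∧_ b z)))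
  negPart≤𝔼negPart a b = begin
    0ℚ ⊔ (fibreT M f b (a [ i ]≔ false) - fibreT M f b (a [ i ]≔ true))
      ≡⟨ cong (0ℚ ⊔_) (𝔼-- ½ (f₀ (a [ i ]≔ false)) (f₀ (a [ i ]≔ true))) ⟨
    0ℚ ⊔ 𝔼 ½ l (λ z → f₀ (a [ i ]≔ false) z - f₀ (a [ i ]≔ true) z)
      ≤⟨ 0⊔𝔼≤𝔼0⊔ l (λ z → f₀ (a [ i ]≔ false) z - f₀ (a [ i ]≔ true) z) ⟩
    𝔼 ½ l (λ z → 0ℚ ⊔ (f₀ (a [ i ]≔ false) z - f₀ (a [ i ]≔ true) z))
      ≡⟨ 𝔼-cong (λ z → cong₂ (λ u v → 0ℚ ⊔ (f u - f v))
                             (merge-[]≔ M a (zipWith _∧_ b z) i false) (merge-[]≔ M a (zipWith _∧_ b z) i true)) ⟩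
    𝔼 ½ l (λ z → Φ (merge M a (zipWith _∧_ b z))) ∎
    where
    f₀ : Cube k → Cube l → ℚ
    f₀ y z = f (merge M y (zipWith _∧_ b z))

𝔼-totalNegInfluence-fibreT : ∀ {n η} (M : Subset n) (f : Cube n → ℚ) → (∀ j → Iminus f j ≤ η) →
  𝔼 ½ ∣ ∁ M ∣ (λ b → totalNegInfluence ½ (fibreT M f b)) ≤ fromℕ (∣ M ∣) * (2ℚ ^ ∣ M ∣ * η)
𝔼-totalNegInfluence-fibreT {η = η} M f I⁻≤η = begin
  𝔼 ½ l (λ b → ∑[ i < k ] negInfluence ½ (fibreT M f b) i)
    ≡⟨ 𝔼-∑ ½ k (λ b i → negInfluence ½ (fibreT M f b) i) ⟩
  ∑[ i < k ] 𝔼 ½ l (λ b → negInfluence ½ (fibreT M f b) i)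
    ≤⟨ ∑-mono-≤ k (λ i → ≤-trans (𝔼-negInfluence-fibreT M f i) (*-monoˡ-≤ (0≤2^ k) (I⁻≤η (embed M i)))) ⟩
  ∑[ i < k ] (2ℚ ^ k * η)
    ≡⟨ ∑-const k (2ℚ ^ k * η) ⟩
  fromℕ k * (2ℚ ^ k * η) ∎
  where
  open ≤-Reasoning
  k l : ℕ
  k = ∣ M ∣
  l = ∣ ∁ M ∣

IM-bound : ∀ {t ζ λ′ η n} → 0ℚ ≤ ζ → 2ℚ ≤ fromℕ (suc t) * ζ → ζ ≤ λ′ →
  (g : Cube n → Bool) (f : Cube n → ℚ) → (∀ x → 0ℚ ≤ f x × f x ≤ 1ℚ) →
  ‖ (λ x → T f x - λ′ * bit (g x)) ‖₁ ≤ η → (∀ i → Iminus f i ≤ η) →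
  (M : Subset n) → ∣ M ∣ ≡ suc t ℕ.* suc t →
  IM (λ x → bit (g x)) M ≤ fromℕ (∣ M ∣) * (2ℚ ^ ∣ M ∣ * η) + fromℕ (∣ M ∣) * (2ℚ ^ ∣ M ∣ * η)
IM-bound {t} {λ′ = λ′} {η} 0≤ζ 2≤rζ ζ≤λ′ g f f∈[0,1] ‖Tf-λ′g‖₁≤η I⁻≤η M ∣M∣≡k = begin
  IM (λ x → bit (g x)) M
    ≡⟨ IM-fibres M (λ x → bit (g x)) ⟩
  𝔼 ½ l (λ b → (fourier (λ a → bit (g (merge M a b))) ⊤) ²)
    ≤⟨ 𝔼-mono-≤ l (λ b → fibre-bound {t} 0≤ζ 2≤rζ ζ≤λ′ ∣M∣≡k
                           (fibreT M f b) (fibreT∈[0,1] M f∈[0,1] b) (λ a → g (merge M a b))) ⟩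
  𝔼 ½ l (λ b → N b + fromℕ k * (2ℚ ^ k * E b))
    ≡⟨ 𝔼-+ ½ N (λ b → fromℕ k * (2ℚ ^ k * E b)) ⟩
  𝔼 ½ l N + 𝔼 ½ l (λ b → fromℕ k * (2ℚ ^ k * E b))
    ≡⟨ cong (𝔼 ½ l N +_) (trans (𝔼-*ˡ ½ (fromℕ k) (λ b → 2ℚ ^ k * E b)) (cong (fromℕ k *_) (𝔼-*ˡ ½ (2ℚ ^ k) E))) ⟩
  𝔼 ½ l N + fromℕ k * (2ℚ ^ k * 𝔼 ½ l E)
    ≤⟨ +-mono-≤ (𝔼-totalNegInfluence-fibreT M f I⁻≤η)
                (*-monoˡ-≤ (0≤fromℕ k) (*-monoˡ-≤ (0≤2^ k)
                  (≤-trans (≤-reflexive (𝔼-fibre-distance≡‖Tf-λ′g‖₁ M f g λ′)) ‖Tf-λ′g‖₁≤η))) ⟩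
  fromℕ k * (2ℚ ^ k * η) + fromℕ k * (2ℚ ^ k * η) ∎
  where
  open ≤-Reasoning
  k l : ℕ
  k = ∣ M ∣
  l = ∣ ∁ M ∣
  N E : Cube l → ℚ
  N b = totalNegInfluence ½ (fibreT M f b)
  E b = ‖ (λ a → T (fibreT M f b) a - λ′ * bit (g (merge M a b))) ‖₁

-- With η = tolerance m τ both error terms of IM-bound are m 2^m η ≤ τ/2, as m ≤ 2^m.
tolerance : ℕ → ℚ → ℚ
tolerance m τ = τ * (½ ^ m * ½ ^ suc m)

0<tolerance : ∀ m {τ} → 0ℚ < τ → 0ℚ < tolerance m τ
0<tolerance m 0<τ = *-pos 0<τ (*-pos (0<½^ m) (0<½^ (suc m)))

tolerance-budget : ∀ m {τ} → 0ℚ ≤ τ → fromℕ m * (2ℚ ^ m * tolerance m τ) + fromℕ m * (2ℚ ^ m * tolerance m τ) ≤ τ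
tolerance-budget m {τ} 0≤τ = begin
  fromℕ m * (p * (τ * (h * (½ * h)))) + fromℕ m * (p * (τ * (h * (½ * h))))
    ≡⟨ solve 4 (λ n p t h → n :* (p :* (t :* (h :* (con ½ :* h)))) :+ n :* (p :* (t :* (h :* (con ½ :* h))))
                          := ((n :* h) :* t) :* (p :* h)) refl (fromℕ m) p τ h ⟩
  ((fromℕ m * h) * τ) * (p * h)
    ≡⟨ trans (cong (((fromℕ m * h) * τ) *_) (2^*½^≡1 m)) (*-identityʳ _) ⟩
  (fromℕ m * h) * τ
    ≤⟨ *-monoʳ-≤-nonNeg τ {{nonNegative 0≤τ}} (*-monoʳ-≤-nonNeg h {{nonNegative (<⇒≤ (0<½^ m))}} (fromℕ≤2^ m)) ⟩
  (p * h) * τ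
    ≡⟨ trans (cong (_* τ) (2^*½^≡1 m)) (*-identityˡ τ) ⟩
  τ ∎
  where
  open ≤-Reasoning
  p h : ℚ
  p = 2ℚ ^ m
  h = ½ ^ m

fromℕ-toℚᵘ : ∀ n → ℚ.toℚᵘ (fromℕ n) ℚᵘ.≃ ℚᵘ.mkℚᵘ (ℤ.+ n) 0
fromℕ-toℚᵘ zero    = ℚᵘ.≃-refl
fromℕ-toℚᵘ (suc n) = ℚᵘ.≃-trans (toℚᵘ-homo-+ 1ℚ (fromℕ n))
  (ℚᵘ.≃-trans (ℚᵘ.+-congʳ (ℚ.toℚᵘ 1ℚ) (fromℕ-toℚᵘ n)) (ℚᵘ.*≡* eq))
  where
  eq : (ℤ.+ 1 ℤ.* ℤ.+ 1 ℤ.+ ℤ.+ n ℤ.* ℤ.+ 1) ℤ.* ℤ.+ 1 ≡ ℤ.+ suc n ℤ.* ℤ.+ 1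
  eq = trans (ℤ.*-identityʳ _) (trans (cong (λ u → ℤ.+ 1 ℤ.+ u) (ℤ.*-identityʳ (ℤ.+ n)))
         (trans (sym (ℤ.pos-+ 1 n)) (sym (ℤ.*-identityʳ (ℤ.+ suc n)))))

*-denominator≡numerator : ∀ ζ {n} → ℚ.↥ ζ ≡ ℤ.+ n → ζ * fromℕ (ℚ.↧ₙ ζ) ≡ fromℕ n
*-denominator≡numerator ζ@(ℚ.mkℚ _ d-1 _) {n} refl = toℚᵘ-injective (begin
  ℚ.toℚᵘ (ζ * fromℕ (suc d-1))
    ≈⟨ toℚᵘ-homo-* ζ (fromℕ (suc d-1)) ⟩
  ℚᵘ.mkℚᵘ (ℤ.+ n) d-1 ℚᵘ.* ℚ.toℚᵘ (fromℕ (suc d-1))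
    ≈⟨ ℚᵘ.*-congˡ {ℚᵘ.mkℚᵘ (ℤ.+ n) d-1} (fromℕ-toℚᵘ (suc d-1)) ⟩
  ℚᵘ.mkℚᵘ (ℤ.+ n) d-1 ℚᵘ.* ℚᵘ.mkℚᵘ (ℤ.+ suc d-1) 0
    ≈⟨ ℚᵘ.*≡* eq ⟩
  ℚᵘ.mkℚᵘ (ℤ.+ n) 0
    ≈⟨ fromℕ-toℚᵘ n ⟨
  ℚ.toℚᵘ (fromℕ n) ∎)
  where
  open ℚᵘ.≃-Reasoning
  eq : (ℤ.+ n ℤ.* ℤ.+ suc d-1) ℤ.* ℤ.+ 1 ≡ ℤ.+ n ℤ.* ℤ.+ (suc d-1 ℕ.* 1)
  eq = trans (ℤ.*-identityʳ _) (cong (λ u → ℤ.+ n ℤ.* ℤ.+ u) (sym (ℕ.*-identityʳ (suc d-1))))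

-- For ζ = (p + 1)/d take t + 1 = 2d, so that (t + 1) ζ = 2(p + 1).
archimedean : ∀ ζ → 0ℚ < ζ → ∃[ t ] 2ℚ ≤ fromℕ (suc t) * ζ
archimedean ζ@(ℚ.mkℚ (ℤ.+ suc p) d-1 _) _ = d-1 ℕ.+ suc d-1 , (begin
  2ℚ                            ≤⟨ +-mono-≤ (1≤1+fromℕ p) (1≤1+fromℕ p) ⟩
  fromℕ (suc p) + fromℕ (suc p) ≡⟨ cong₂ _+_ (*-denominator≡numerator ζ refl) (*-denominator≡numerator ζ refl) ⟨
  ζ * d + ζ * d                 ≡⟨ solve 2 (λ z d → z :* d :+ z :* d := (d :+ d) :* z) refl ζ d ⟩
  (d + d) * ζ                   ≡⟨ cong (_* ζ) (fromℕ-+ (suc d-1) (suc d-1)) ⟨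
  fromℕ (suc d-1 ℕ.+ suc d-1) * ζ ∎)
  where
  open ≤-Reasoning
  d : ℚ
  d = fromℕ (suc d-1)
archimedean (ℚ.mkℚ (ℤ.+ zero) _ _) (ℚ.*<* (ℤ.+<+ ()))
archimedean (ℚ.mkℚ ℤ.-[1+ _ ] _ _) (ℚ.*<* ())

claim5p3 : (ζ : ℚ) → 0ℚ < ζ →
    ∃[ m ] ((τ : ℚ) → 0ℚ < τ →
      ∃[ η₂ ] (0ℚ < η₂ ×
        ((λ' : ℚ) → ζ ≤ λ' → λ' ≤ 1ℚ →
         (n : ℕ) (g : Cube n → Bool) (f : Cube n → ℚ) →
         ((x : Cube n) → 0ℚ ≤ f x × f x ≤ 1ℚ) →
         ‖ (λ x → T f x - λ' * bit (g x)) ‖₁ ≤ η₂ →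
         ((i : Fin n) → Iminus f i ≤ η₂) →
         (M : Subset n) → ∣ M ∣ ≡ m →
         IM (λ x → bit (g x)) M ≤ τ)))
claim5p3 ζ 0<ζ with archimedean ζ 0<ζ
... | t , 2≤[1+t]ζ = m , λ τ 0<τ → tolerance m τ , 0<tolerance m 0<τ ,
  λ λ′ ζ≤λ′ _ n g f f∈[0,1] ‖Tf-λ′g‖₁≤η I⁻≤η M ∣M∣≡m →
    ≤-trans (IM-bound {t} (<⇒≤ 0<ζ) 2≤[1+t]ζ ζ≤λ′ g f f∈[0,1] ‖Tf-λ′g‖₁≤η I⁻≤η M ∣M∣≡m)
            (subst (λ k → fromℕ k * (2ℚ ^ k * tolerance m τ) + fromℕ k * (2ℚ ^ k * tolerance m τ) ≤ τ) (sym ∣M∣≡m)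
                   (tolerance-budget m (<⇒≤ 0<τ)))
  where
  m : ℕ
  m = suc t ℕ.* suc t
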